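{- Let $G$ be a circulant graph such that ${\rm Ind}(G)$ is vertex decomposable, respectively shellable. Then for every $m\geq 1$, the lexicographical product $G[K_m]$ is a circulant graph whose independence complex ${\rm Ind}(G[K_m])$ is also vertex decomposable, respectively shellable.
   Context: For $n\ge 1$ and $S\subseteq\{1,2,\ldots,\lfloor n/2\rfloor\}$, the circulant graph $C_n(S)$ has vertex set $\{x_0,\ldots,x_{n-1}\}$, with $\{x_a,x_b\}$ an edge iff $|a-b|\in S$ or $n-|a-b|\in S$; a circulant graph is a graph of this form. For graphs $G=(V_G,E_G)$, $H=(V_H,E_H)$, the lexicographical product $G[H]$ has vertex set $V_G\times V_H$, with $(w,x)$ and $(y,z)$ adjacent if $\{w,y\}\in E_G$, or if $w=y$ and $\{x,z\}\in E_H$. $K_m$ is the complete graph on $m$ vertices. ${\rm Ind}(G)$ is the simplicial complex of independent sets of $G$. A pure simplicial complex $\Delta$ is shellable if its facets (maximal faces) can be ordered $F_1,\ldots,F_s$ so that for all $1\le j<i\le s$ there exist $x\in F_i\setminus F_j$ and $k<i$ with $\{x\}=F_i\setminus F_k$. A pure simplicial complex $\Delta$ is vertex decomposable if it has a unique facet, or there is a vertex $x$ such that ${\rm del}_\Delta(x)=\{F\in\Delta: x\notin F\}$ and ${\rm link}_\Delta(x)=\{F\in\Delta: x\notin F,\ F\cup\{x\}\in\Delta\}$ are vertex decomposable. -}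

module Defs where

open import Data.Nat as ℕ using (ℕ; _≤_; ∣_-_∣; _∸_; _/_)
open import Data.Fin as Fin using (Fin; toℕ; remQuot)
open import Data.Fin.Subset using (Subset; _∈_; _∉_; _⊆_; _∪_; _─_; ⁅_⁆; ∣_∣)
open import Data.List using (List)
open import Data.List.Relation.Unary.All using (All)
import Data.List.Membership.Propositional as LMem
open import Data.Product using (Σ; ∃; ∃-syntax; _×_; _,_; proj₁; proj₂)
open import Data.Sum using (_⊎_)
open import Relation.Nullary using (¬_)
open import Relation.Binary.PropositionalEquality using (_≡_)
open import Function.Bundles using (_↔_; Inverse; _⇔_)

record Graph : Set₁ where
  field
    size : ℕ
    Adj  : Fin size → Fin size → Set
open Graph public

_≅_ : Graph → Graph → Set
G ≅ H = Σ (Fin (size G) ↔ Fin (size H)) λ σ →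
          ∀ a b → Adj G a b ⇔ Adj H (Inverse.to σ a) (Inverse.to σ b)

Circ : (n : ℕ) → List ℕ → Graph
Circ n S = record
  { size = n
  ; Adj  = λ a b → (∣ toℕ a - toℕ b ∣ LMem.∈ S) ⊎ ((n ∸ ∣ toℕ a - toℕ b ∣) LMem.∈ S)
  }

IsCirculant : Graph → Set
IsCirculant G = Σ ℕ λ n → Σ (List ℕ) λ S →
  (1 ≤ n) × All (λ s → 1 ≤ s × s ≤ n / 2) S × (G ≅ Circ n S)

K : ℕ → Graph
K m = record { size = m ; Adj = λ i j → ¬ (i ≡ j) }

-- Lexicographic product G[H]; vertex set V_G × V_H encoded as Fin (|V_G| * |V_H|)
-- via remQuot (a bijection Fin (n * m) ≅ Fin n × Fin m)
Lex : Graph → Graph → Graph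
Lex G H = record
  { size = size G ℕ.* size H
  ; Adj  = λ u v →
      let w = proj₁ (remQuot {size G} (size H) u) ; x = proj₂ (remQuot {size G} (size H) u)
          y = proj₁ (remQuot {size G} (size H) v) ; z = proj₂ (remQuot {size G} (size H) v)
      in Adj G w y ⊎ (w ≡ y × Adj H x z)
  }

Complex : ℕ → Set₁
Complex n = Subset n → Set

Ind : (G : Graph) → Complex (size G)
Ind G F = ∀ a b → a ∈ F → b ∈ F → ¬ Adj G a b

IsFacet : ∀ {n} → Complex n → Subset n → Set
IsFacet Δ F = Δ F × (∀ F′ → Δ F′ → F ⊆ F′ → F ≡ F′)

Pure : ∀ {n} → Complex n → Set
Pure Δ = ∀ F F′ → IsFacet Δ F → IsFacet Δ F′ → ∣ F ∣ ≡ ∣ F′ ∣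

UniqueFacet : ∀ {n} → Complex n → Set
UniqueFacet Δ = Σ _ λ F → IsFacet Δ F × (∀ F′ → IsFacet Δ F′ → F′ ≡ F)

del : ∀ {n} → Complex n → Fin n → Complex n
del Δ x F = Δ F × x ∉ F

link : ∀ {n} → Complex n → Fin n → Complex n
link Δ x F = Δ F × x ∉ F × Δ (F ∪ ⁅ x ⁆)

data VertexDecomposable {n : ℕ} : Complex n → Set₁ where
  vd-unique : ∀ {Δ} → Pure Δ → UniqueFacet Δ → VertexDecomposable Δ
  vd-split  : ∀ {Δ} → Pure Δ → (x : Fin n) → Δ ⁅ x ⁆ →
              VertexDecomposable (del Δ x) → VertexDecomposable (link Δ x) →
              VertexDecomposable Δ

Shellable : ∀ {n} → Complex n → Set
Shellable {n} Δ = Pure Δ × Σ ℕ λ s → Σ (Fin s → Subset n) λ F →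
    (∀ i j → F i ≡ F j → i ≡ j)
  × (∀ i → IsFacet Δ (F i))
  × (∀ F′ → IsFacet Δ F′ → ∃ λ i → F i ≡ F′)
  × (∀ i j → j Fin.< i →
       ∃ λ x → x ∈ (F i ─ F j) × ∃ λ k → k Fin.< i × (F i ─ F k ≡ ⁅ x ⁆))

module Submission where

-- Let H = G[K_m] and order its N = |V(G)|·m vertices.  Stage t of H consists
-- of the copies (v,0) and the vertices of index < t.  Stage 0 induces a copy of
-- G, so its independence complex is Ind(G) transported along v ↦ (v,0); each
-- later vertex y = (v,i), i ≠ 0, is a twin of (v,0), already present, and adding
-- a twin turns the independence complex Δ into the duplication dup Δ, in which y
-- may take the place of x.  Transport and duplication both preserve vertex
-- decomposability (shed y first) and shellability (append the duplicated
-- facets), and stage N is all of H.  For circulance, G ≅ C_k(S) via τ gives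
-- G[K_m] ≅ C_{mk}(S′) via (v,i) ↦ τ(v) + i·k, with S′ the 1 ≤ d ≤ ⌊mk/2⌋ whose
-- residue modulo k is 0, in S, or in k − S.

open import Defs
open import Data.Nat as ℕ using (ℕ; zero; suc; _≤_; _<_; z≤n; s≤s; _%_; _∸_; _+_; _*_)
import Data.Nat.Properties as ℕP
import Data.Nat.DivMod as DM
open import Data.Bool using (true; false)
open import Data.Fin as Fin using (Fin; toℕ)
import Data.Fin.Properties as FinP
open import Data.Fin.Subset using (Subset; _∈_; _∉_; _⊆_; _∪_; _─_; ⁅_⁆; ∣_∣; ⊥)
open import Data.Fin.Subset.Properties
  using (_∈?_; _⊆?_; x∈⁅x⁆; x∈⁅y⁆⇒x≡y; x≢y⇒x∉⁅y⁆; x∈p∪q⁻; x∈p∪q⁺; x∈p∧x∉q⇒x∈p─q; p─q⊆p;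
         ⊆-antisym; ∪-identityˡ; ∪-identityʳ; ∉⊥; nonempty?; Empty-unique; ∣p∣≤n; ∣⊥∣≡0)
open import Data.Vec using (_∷_; tabulate; here; there)
open import Data.Vec.Properties using (lookup⇒[]=; []=⇒lookup; lookup∘tabulate)
open import Data.Product using (Σ; ∃; _×_; _,_; proj₁; proj₂)
open import Data.Sum using (_⊎_; inj₁; inj₂; [_,_]′)
open import Data.Empty using (⊥-elim)
open import Relation.Nullary using (¬_; Dec; yes; no; does)
open import Relation.Nullary.Decidable using (dec-true)
open import Relation.Nullary.Decidable.Core using (_×-dec_; _→-dec_)
open import Data.List as List using (List; _++_; map; length)
import Data.List.Membership.DecPropositional as ListDec
open import Function.Bundles using (Inverse; Equivalence; _↔_; _⇔_; mk↔ₛ′; mk⇔)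
open import Data.List.Relation.Unary.Any using () renaming (here to hereL; there to thereL)
import Data.List.Relation.Unary.All as All
open import Data.List.Relation.Unary.All using (All)
open import Data.List.Relation.Unary.AllPairs as AllPairs using (AllPairs)
import Data.List.Relation.Unary.AllPairs.Properties as AllPairsP
open import Data.List.Membership.Propositional using () renaming (_∈_ to _∈L_)
open import Data.List.Membership.Propositional.Properties
  using (∈-map⁺; ∈-map⁻; ∈-++⁺ˡ; ∈-++⁺ʳ; ∈-++⁻; ∈-filter⁺; ∈-filter⁻; ∈-upTo⁺; ∈-upTo⁻)
open import Relation.Binary.PropositionalEquality
  using (_≡_; _≢_; refl; sym; trans; cong; cong₂; subst; subst₂; module ≡-Reasoning)

∈∪⁻ : ∀ {n} {x : Fin n} {p q : Subset n} → x ∈ p ∪ q → x ∈ p ⊎ x ∈ q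
∈∪⁻ {p = p} {q} = x∈p∪q⁻ p q

∈─⁻ : ∀ {n} {x : Fin n} {p q : Subset n} → x ∈ p ─ q → x ∈ p × x ∉ q
∈─⁻ {p = p} {q} m = p─q⊆p p q m , ∉q p q m
  where
  ∉q : ∀ {k} {z : Fin k} (p q : Subset k) → z ∈ p ─ q → z ∉ q
  ∉q (true ∷ p) (false ∷ q) here = λ ()
  ∉q (s ∷ p) (t ∷ q) (there m) (there k) = ∉q p q m k

∈⁅⁆⁻ : ∀ {n} {x y : Fin n} → x ∈ ⁅ y ⁆ → x ≡ y
∈⁅⁆⁻ {y = y} = x∈⁅y⁆⇒x≡y y

∈⁅⁆⁺ : ∀ {n} {x y : Fin n} → x ≡ y → x ∈ ⁅ y ⁆
∈⁅⁆⁺ {x = x} refl = x∈⁅x⁆ x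

∣p∪⁅x⁆∣ : ∀ {n} (x : Fin n) (p : Subset n) → x ∉ p → ∣ p ∪ ⁅ x ⁆ ∣ ≡ suc ∣ p ∣
∣p∪⁅x⁆∣ Fin.zero (true ∷ p) x∉p = ⊥-elim (x∉p here)
∣p∪⁅x⁆∣ Fin.zero (false ∷ p) _ = cong (λ r → suc ∣ r ∣) (∪-identityʳ p)
∣p∪⁅x⁆∣ (Fin.suc x) (true ∷ p) x∉p = cong suc (∣p∪⁅x⁆∣ x p (λ m → x∉p (there m)))
∣p∪⁅x⁆∣ (Fin.suc x) (false ∷ p) x∉p = ∣p∪⁅x⁆∣ x p (λ m → x∉p (there m))

p≡p─x∪x : ∀ {n} {x : Fin n} {p : Subset n} → x ∈ p → p ≡ (p ─ ⁅ x ⁆) ∪ ⁅ x ⁆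
p≡p─x∪x {x = x} {p} x∈p = ⊆-antisym to fr
  where
  to : p ⊆ (p ─ ⁅ x ⁆) ∪ ⁅ x ⁆
  to {u} m with u FinP.≟ x
  ... | yes u≡x = x∈p∪q⁺ (inj₂ (∈⁅⁆⁺ u≡x))
  ... | no u≢x = x∈p∪q⁺ (inj₁ (x∈p∧x∉q⇒x∈p─q m (x≢y⇒x∉⁅y⁆ u≢x)))
  fr : (p ─ ⁅ x ⁆) ∪ ⁅ x ⁆ ⊆ p
  fr m = [ p─q⊆p p ⁅ x ⁆ , (λ k → subst (_∈ p) (sym (∈⁅⁆⁻ k)) x∈p) ]′ (∈∪⁻ m)

∣p∣≡1+∣p─x∣ : ∀ {n} (x : Fin n) (p : Subset n) → x ∈ p → ∣ p ∣ ≡ suc ∣ p ─ ⁅ x ⁆ ∣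
∣p∣≡1+∣p─x∣ x p x∈p =
  trans (cong ∣_∣ (p≡p─x∪x x∈p)) (∣p∪⁅x⁆∣ x (p ─ ⁅ x ⁆) (λ m → proj₂ (∈─⁻ m) (x∈⁅x⁆ x)))

exchange : ∀ {n} → Fin n → Fin n → Subset n → Subset n
exchange a b F = (F ─ ⁅ b ⁆) ∪ ⁅ a ⁆

module _ {n : ℕ} {a b u : Fin n} {F : Subset n} where

  exchange⁻ : u ∈ exchange a b F → (u ∈ F × u ≢ b) ⊎ u ≡ a
  exchange⁻ m with ∈∪⁻ m
  ... | inj₁ k = inj₁ (proj₁ (∈─⁻ k) , λ u≡b → proj₂ (∈─⁻ k) (∈⁅⁆⁺ u≡b))
  ... | inj₂ k = inj₂ (∈⁅⁆⁻ k)

  exchange⁺ : u ∈ F → u ≢ b → u ∈ exchange a b F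
  exchange⁺ m u≢b = x∈p∪q⁺ (inj₁ (x∈p∧x∉q⇒x∈p─q m (x≢y⇒x∉⁅y⁆ u≢b)))

exchange-new : ∀ {n} {a b : Fin n} {F} → a ∈ exchange a b F
exchange-new {a = a} = x∈p∪q⁺ (inj₂ (x∈⁅x⁆ a))

∣exchange∣ : ∀ {n} (a b : Fin n) (F : Subset n) → b ∈ F → a ∉ F → ∣ exchange a b F ∣ ≡ ∣ F ∣
∣exchange∣ a b F b∈F a∉F =
  trans (∣p∪⁅x⁆∣ a (F ─ ⁅ b ⁆) (λ k → a∉F (proj₁ (∈─⁻ k)))) (sym (∣p∣≡1+∣p─x∣ b F b∈F))

exchange-involutive : ∀ {n} {a b : Fin n} {F} → a ∈ F → b ∉ F → exchange a b (exchange b a F) ≡ F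
exchange-involutive {a = a} {b} {F} a∈F b∉F = ⊆-antisym to fr
  where
  to : exchange a b (exchange b a F) ⊆ F
  to m with exchange⁻ m
  ... | inj₂ refl = a∈F
  ... | inj₁ (m′ , u≢b) with exchange⁻ m′
  ... | inj₁ (u∈F , _) = u∈F
  ... | inj₂ u≡b = ⊥-elim (u≢b u≡b)
  fr : F ⊆ exchange a b (exchange b a F)
  fr {u} m with u FinP.≟ a
  ... | yes refl = exchange-new
  ... | no u≢a = exchange⁺ (exchange⁺ m u≢a) (λ { refl → b∉F m })

-- Complexes with the same faces.  Faces are predicates, so "same" means
-- logically equivalent; every notion below is invariant under it.

_≋_ : ∀ {n} → Complex n → Complex n → Set
Δ ≋ Δ′ = ∀ F → (Δ F → Δ′ F) × (Δ′ F → Δ F)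

≋-sym : ∀ {n} {Δ Δ′ : Complex n} → Δ ≋ Δ′ → Δ′ ≋ Δ
≋-sym e F = proj₂ (e F) , proj₁ (e F)

module _ {n : ℕ} {Δ Δ′ : Complex n} (e : Δ ≋ Δ′) where

  facet-≋ : ∀ {F} → IsFacet Δ F → IsFacet Δ′ F
  facet-≋ (d , maximal) = proj₁ (e _) d , λ F′ d′ → maximal F′ (proj₂ (e F′) d′)

  del-≋ : ∀ x → del Δ x ≋ del Δ′ x
  del-≋ x F = (λ { (d , m) → proj₁ (e F) d , m }) , (λ { (d , m) → proj₂ (e F) d , m })

  link-≋ : ∀ x → link Δ x ≋ link Δ′ x
  link-≋ x F = (λ { (d , m , d′) → proj₁ (e F) d , m , proj₁ (e _) d′ })
             , (λ { (d , m , d′) → proj₂ (e F) d , m , proj₂ (e _) d′ })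

pure-≋ : ∀ {n} {Δ Δ′ : Complex n} → Δ ≋ Δ′ → Pure Δ → Pure Δ′
pure-≋ e pure F F′ f f′ = pure F F′ (facet-≋ (≋-sym e) f) (facet-≋ (≋-sym e) f′)

uniqueFacet-≋ : ∀ {n} {Δ Δ′ : Complex n} → Δ ≋ Δ′ → UniqueFacet Δ → UniqueFacet Δ′
uniqueFacet-≋ e (F , f , unique) = F , facet-≋ e f , λ F′ f′ → unique F′ (facet-≋ (≋-sym e) f′)

vd-≋ : ∀ {n} {Δ Δ′ : Complex n} → Δ ≋ Δ′ → VertexDecomposable Δ → VertexDecomposable Δ′
vd-≋ e (vd-unique p u) = vd-unique (pure-≋ e p) (uniqueFacet-≋ e u)
vd-≋ e (vd-split p x d vd vl) =
  vd-split (pure-≋ e p) x (proj₁ (e _) d) (vd-≋ (del-≋ e x) vd) (vd-≋ (link-≋ e x) vl)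

unique⇒pure : ∀ {n} {Δ : Complex n} → UniqueFacet Δ → Pure Δ
unique⇒pure (_ , _ , unique) F F′ f f′ = cong ∣_∣ (trans (unique F f) (sym (unique F′ f′)))

-- Complexes whose faces are decidable and closed under subsets; these
-- properties are needed to extend faces to facets.

DecidableFaces : ∀ {n} → Complex n → Set
DecidableFaces Δ = ∀ F → Dec (Δ F)

DownClosed : ∀ {n} → Complex n → Set
DownClosed Δ = ∀ {F G} → G ⊆ F → Δ F → Δ G

module _ {n : ℕ} {Δ : Complex n} where

  dec-del : DecidableFaces Δ → ∀ z → DecidableFaces (del Δ z)
  dec-del dec z F with dec F | z ∈? F
  ... | yes d | no z∉F = yes (d , z∉F)
  ... | no ¬d | _ = no (λ w → ¬d (proj₁ w))
  ... | yes d | yes z∈F = no (λ w → proj₂ w z∈F)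

  dec-link : DecidableFaces Δ → ∀ z → DecidableFaces (link Δ z)
  dec-link dec z F with dec F | z ∈? F | dec (F ∪ ⁅ z ⁆)
  ... | yes d | no z∉F | yes d′ = yes (d , z∉F , d′)
  ... | no ¬d | _ | _ = no (λ w → ¬d (proj₁ w))
  ... | yes d | yes z∈F | _ = no (λ w → proj₁ (proj₂ w) z∈F)
  ... | yes d | no z∉F | no ¬d′ = no (λ w → ¬d′ (proj₂ (proj₂ w)))

  down-del : DownClosed Δ → ∀ z → DownClosed (del Δ z)
  down-del down z G⊆F (d , z∉F) = down G⊆F d , λ z∈G → z∉F (G⊆F z∈G)

  down-link : DownClosed Δ → ∀ z → DownClosed (link Δ z)
  down-link down z {F} {G} G⊆F (d , z∉F , d′) = down G⊆F d , (λ z∈G → z∉F (G⊆F z∈G)) , down G∪z⊆F∪z d′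
    where
    G∪z⊆F∪z : G ∪ ⁅ z ⁆ ⊆ F ∪ ⁅ z ⁆
    G∪z⊆F∪z m = x∈p∪q⁺ ([ (λ k → inj₁ (G⊆F k)) , inj₂ ]′ (∈∪⁻ m))

-- Every face of a decidable, down-closed complex lies in a facet: add vertices
-- while possible; each addition increases the size, which is bounded by n.
module _ {n : ℕ} {Δ : Complex n} (dec : DecidableFaces Δ) (down : DownClosed Δ) where

  private
    Addable : Subset n → Fin n → Set
    Addable F v = v ∉ F × Δ (F ∪ ⁅ v ⁆)

    addable? : ∀ F v → Dec (Addable F v)
    addable? F v with v ∈? F | dec (F ∪ ⁅ v ⁆)
    ... | yes v∈F | _ = no (λ a → proj₁ a v∈F)
    ... | no v∉F | yes d = yes (v∉F , d)
    ... | no v∉F | no ¬d = no (λ a → ¬d (proj₂ a))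

    saturated⇒facet : ∀ F → Δ F → ¬ (∃ λ v → Addable F v) → IsFacet Δ F
    saturated⇒facet F d ¬add = d , λ F′ d′ F⊆F′ → ⊆-antisym F⊆F′ (F′⊆F F′ d′ F⊆F′)
      where
      F′⊆F : ∀ F′ → Δ F′ → F ⊆ F′ → F′ ⊆ F
      F′⊆F F′ d′ F⊆F′ {u} u∈F′ with u ∈? F
      ... | yes u∈F = u∈F
      ... | no u∉F = ⊥-elim (¬add (u , u∉F , down F∪u⊆F′ d′))
        where
        F∪u⊆F′ : F ∪ ⁅ u ⁆ ⊆ F′
        F∪u⊆F′ m = [ F⊆F′ , (λ k → subst (_∈ F′) (sym (∈⁅⁆⁻ k)) u∈F′) ]′ (∈∪⁻ m)

    -- k bounds the number of vertices that can still be added.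
    grow : ∀ k F → n ≤ ∣ F ∣ + k → Δ F → ∃ λ F′ → IsFacet Δ F′ × F ⊆ F′
    grow k F bound d with FinP.any? (addable? F)
    ... | no ¬add = F , saturated⇒facet F d ¬add , λ m → m
    grow zero F bound d | yes (v , v∉F , d′) =
      ⊥-elim (ℕP.<-irrefl refl (ℕP.≤-trans (subst (_≤ n) (∣p∪⁅x⁆∣ v F v∉F) (∣p∣≤n (F ∪ ⁅ v ⁆)))
                                            (subst (n ≤_) (ℕP.+-identityʳ _) bound)))
    grow (suc k) F bound d | yes (v , v∉F , d′)
      with grow k (F ∪ ⁅ v ⁆)
             (subst (n ≤_) (trans (ℕP.+-suc _ k) (cong (_+ k) (sym (∣p∪⁅x⁆∣ v F v∉F)))) bound) d′
    ... | F′ , f , F∪v⊆F′ = F′ , f , λ m → F∪v⊆F′ (x∈p∪q⁺ (inj₁ m))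

  extendToFacet : ∀ F → Δ F → ∃ λ F′ → IsFacet Δ F′ × F ⊆ F′
  extendToFacet F = grow n F (ℕP.m≤n+m n ∣ F ∣)

  uniqueFacet-link : ∀ F → IsFacet Δ F → (∀ F′ → IsFacet Δ F′ → F′ ≡ F) →
                     ∀ z → z ∈ F → UniqueFacet (link Δ z)
  uniqueFacet-link F (dF , _) unique z z∈F = F ─ ⁅ z ⁆ , (face , maximal) , only
    where
    z∉F─z : z ∉ F ─ ⁅ z ⁆
    z∉F─z k = proj₂ (∈─⁻ k) (x∈⁅x⁆ z)
    face : link Δ z (F ─ ⁅ z ⁆)
    face = down (p─q⊆p F ⁅ z ⁆) dF , z∉F─z , subst Δ (p≡p─x∪x z∈F) dF
    inside : ∀ G → link Δ z G → G ⊆ F ─ ⁅ z ⁆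
    inside G (_ , z∉G , d′) {u} u∈G with extendToFacet _ d′
    ... | F′ , f′ , G∪z⊆F′ =
      x∈p∧x∉q⇒x∈p─q (subst (u ∈_) (unique F′ f′) (G∪z⊆F′ (x∈p∪q⁺ (inj₁ u∈G))))
                      (λ k → z∉G (subst (_∈ G) (∈⁅⁆⁻ k) u∈G))
    maximal : ∀ G → link Δ z G → F ─ ⁅ z ⁆ ⊆ G → F ─ ⁅ z ⁆ ≡ G
    maximal G lG sub = ⊆-antisym sub (inside G lG)
    only : ∀ G → IsFacet (link Δ z) G → G ≡ F ─ ⁅ z ⁆
    only G (lG , maxG) = maxG _ face (inside G lG)

Ghost : ∀ {n} → Complex n → Fin n → Set
Ghost Δ z = ∀ F → Δ F → z ∉ F

-- When y is a ghost of Δ, y becomes a copy of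
-- x that can never appear together with x.

module Duplication {n : ℕ} (x y : Fin n) (x≢y : x ≢ y) where

  toX : Subset n → Subset n
  toX = exchange x y
  toY : Subset n → Subset n
  toY = exchange y x

  dup : Complex n → Complex n
  dup Δ F = Δ F ⊎ (y ∈ F × x ∉ F × Δ (toX F))

  y∈toY : ∀ {F} → y ∈ toY F
  y∈toY = exchange-new
  x∈toX : ∀ {F} → x ∈ toX F
  x∈toX = exchange-new

  x∉toY : ∀ {F} → x ∉ toY F
  x∉toY m with exchange⁻ m
  ... | inj₁ (_ , x≢x) = x≢x refl
  ... | inj₂ x≡y = x≢y x≡y

  toY-toX : ∀ {F} → y ∈ F → x ∉ F → toY (toX F) ≡ F
  toY-toX = exchange-involutive {a = y} {b = x}

  toX-toY : ∀ {F} → x ∈ F → y ∉ F → toX (toY F) ≡ F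
  toX-toY = exchange-involutive {a = x} {b = y}

  toX-mono : ∀ {G F} → G ⊆ F → toX G ⊆ toX F
  toX-mono G⊆F m with exchange⁻ m
  ... | inj₁ (m′ , u≢y) = exchange⁺ (G⊆F m′) u≢y
  ... | inj₂ refl = x∈toX

  ⊆toX : ∀ {G F} → G ⊆ F → y ∉ G → G ⊆ toX F
  ⊆toX G⊆F y∉G m = exchange⁺ (G⊆F m) (λ { refl → y∉G m })

  toX-∪y : ∀ {F} → y ∉ F → toX (F ∪ ⁅ y ⁆) ≡ F ∪ ⁅ x ⁆
  toX-∪y {F} y∉F = ⊆-antisym to fr
    where
    to : toX (F ∪ ⁅ y ⁆) ⊆ F ∪ ⁅ x ⁆
    to m with exchange⁻ m
    ... | inj₂ u≡x = x∈p∪q⁺ (inj₂ (∈⁅⁆⁺ u≡x))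
    ... | inj₁ (m′ , u≢y) with ∈∪⁻ m′
    ... | inj₁ k = x∈p∪q⁺ (inj₁ k)
    ... | inj₂ k = ⊥-elim (u≢y (∈⁅⁆⁻ k))
    fr : F ∪ ⁅ x ⁆ ⊆ toX (F ∪ ⁅ y ⁆)
    fr m with ∈∪⁻ m
    ... | inj₁ k = exchange⁺ (x∈p∪q⁺ (inj₁ k)) (λ { refl → y∉F k })
    ... | inj₂ k with ∈⁅⁆⁻ k
    ... | refl = x∈toX

  toX-∪ : ∀ {F z} → z ≢ y → toX (F ∪ ⁅ z ⁆) ≡ toX F ∪ ⁅ z ⁆
  toX-∪ {F} {z} z≢y = ⊆-antisym to fr
    where
    to : toX (F ∪ ⁅ z ⁆) ⊆ toX F ∪ ⁅ z ⁆
    to m with exchange⁻ m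
    ... | inj₂ refl = x∈p∪q⁺ (inj₁ x∈toX)
    ... | inj₁ (m′ , u≢y) with ∈∪⁻ m′
    ... | inj₁ k = x∈p∪q⁺ (inj₁ (exchange⁺ k u≢y))
    ... | inj₂ k = x∈p∪q⁺ (inj₂ k)
    fr : toX F ∪ ⁅ z ⁆ ⊆ toX (F ∪ ⁅ z ⁆)
    fr m with ∈∪⁻ m
    ... | inj₁ k = toX-mono (λ k′ → x∈p∪q⁺ (inj₁ k′)) k
    ... | inj₂ k with ∈⁅⁆⁻ k
    ... | refl = exchange⁺ (x∈p∪q⁺ (inj₂ (x∈⁅x⁆ z))) z≢y

  ∈toX⁻ : ∀ {F z} → z ≢ x → z ∈ toX F → z ∈ F
  ∈toX⁻ z≢x m with exchange⁻ m
  ... | inj₁ (m′ , _) = m′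
  ... | inj₂ z≡x = ⊥-elim (z≢x z≡x)

  module _ {Δ : Complex n} (ghost : Ghost Δ y) where

    facet-dup : ∀ {F} → IsFacet Δ F → IsFacet (dup Δ) F
    facet-dup {F} (d , maximal) = inj₁ d , maximal′
      where
      maximal′ : ∀ H → dup Δ H → F ⊆ H → F ≡ H
      maximal′ H (inj₁ dH) F⊆H = maximal H dH F⊆H
      maximal′ H (inj₂ (_ , x∉H , dX)) F⊆H =
        ⊥-elim (x∉H (F⊆H (subst (x ∈_) (sym (maximal _ dX (⊆toX F⊆H (ghost F d)))) x∈toX)))

    facet-dupY : ∀ {F} → IsFacet Δ F → x ∈ F → IsFacet (dup Δ) (toY F)
    facet-dupY {F} (d , maximal) x∈F =
      inj₂ (y∈toY , x∉toY , subst Δ (sym (toX-toY x∈F (ghost F d))) d) , maximal′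
      where
      maximal′ : ∀ H → dup Δ H → toY F ⊆ H → toY F ≡ H
      maximal′ H (inj₁ dH) sub = ⊥-elim (ghost H dH (sub y∈toY))
      maximal′ H (inj₂ (y∈H , x∉H , dX)) sub = trans (cong toY (maximal _ dX F⊆toX-H)) (toY-toX y∈H x∉H)
        where
        F⊆toX-H : F ⊆ toX H
        F⊆toX-H {u} m with u FinP.≟ x
        ... | yes refl = x∈toX
        ... | no u≢x = exchange⁺ (sub (exchange⁺ m u≢x)) (λ { refl → ghost F d m })

    DupFacet : Subset n → Set
    DupFacet G = (y ∉ G × IsFacet Δ G) ⊎ (y ∈ G × x ∉ G × IsFacet Δ (toX G))

    facet-dup⁻ : ∀ {G} → IsFacet (dup Δ) G → DupFacet G
    facet-dup⁻ {G} (inj₁ d , maximal) = inj₁ (ghost G d , d , λ H dH → maximal H (inj₁ dH))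
    facet-dup⁻ {G} (inj₂ (y∈G , x∉G , dX) , maximal) = inj₂ (y∈G , x∉G , dX , maximal′)
      where
      maximal′ : ∀ H → Δ H → toX G ⊆ H → toX G ≡ H
      maximal′ H dH sub = trans (cong toX (maximal _ dY G⊆toY-H)) (toX-toY x∈H (ghost H dH))
        where
        x∈H : x ∈ H
        x∈H = sub x∈toX
        dY : dup Δ (toY H)
        dY = inj₂ (y∈toY , x∉toY , subst Δ (sym (toX-toY x∈H (ghost H dH))) dH)
        G⊆toY-H : G ⊆ toY H
        G⊆toY-H {u} m with u FinP.≟ y
        ... | yes refl = y∈toY
        ... | no u≢y = exchange⁺ (sub (exchange⁺ m u≢y)) (λ { refl → x∉G m })

    pure-dup : Pure Δ → Pure (dup Δ)
    pure-dup pure G G′ f f′ = trans (sym (size≡ (facet-dup⁻ f)))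
                                    (trans (pure _ _ (baseFacet (facet-dup⁻ f)) (baseFacet (facet-dup⁻ f′)))
                                           (size≡ (facet-dup⁻ f′)))
      where
      base : ∀ {G} → DupFacet G → Subset n
      base {G} (inj₁ _) = G
      base {G} (inj₂ _) = toX G
      size≡ : ∀ {G} (c : DupFacet G) → ∣ base c ∣ ≡ ∣ G ∣
      size≡ (inj₁ _) = refl
      size≡ {G} (inj₂ (y∈G , x∉G , _)) = ∣exchange∣ x y G y∈G x∉G
      baseFacet : ∀ {G} (c : DupFacet G) → IsFacet Δ (base c)
      baseFacet (inj₁ (_ , f)) = f
      baseFacet (inj₂ (_ , _ , f)) = f

    del-dup-y : del (dup Δ) y ≋ Δ
    del-dup-y F = (λ { (inj₁ d , _) → d ; (inj₂ (y∈F , _) , y∉F) → ⊥-elim (y∉F y∈F) })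
                , (λ d → inj₁ d , ghost F d)

    link-dup-y : link (dup Δ) y ≋ link Δ x
    link-dup-y F = to , fr
      where
      to : link (dup Δ) y F → link Δ x F
      to (inj₂ (y∈F , _) , y∉F , _) = ⊥-elim (y∉F y∈F)
      to (inj₁ d , y∉F , inj₁ d′) = ⊥-elim (ghost _ d′ (x∈p∪q⁺ (inj₂ (x∈⁅x⁆ y))))
      to (inj₁ d , y∉F , inj₂ (_ , x∉F∪y , dX)) =
        d , (λ k → x∉F∪y (x∈p∪q⁺ (inj₁ k))) , subst Δ (toX-∪y y∉F) dX
      fr : link Δ x F → link (dup Δ) y F
      fr (d , x∉F , dFx) = inj₁ d , ghost F d ,
        inj₂ (x∈p∪q⁺ (inj₂ (x∈⁅x⁆ y)) , x∉F∪y , subst Δ (sym (toX-∪y (ghost F d))) dFx)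
        where
        x∉F∪y : x ∉ F ∪ ⁅ y ⁆
        x∉F∪y k = [ x∉F , (λ k′ → x≢y (∈⁅⁆⁻ k′)) ]′ (∈∪⁻ k)

    module _ {z : Fin n} (z≢x : z ≢ x) (z≢y : z ≢ y) where

      del-dup : del (dup Δ) z ≋ dup (del Δ z)
      del-dup F =
          (λ { (inj₁ d , z∉F) → inj₁ (d , z∉F)
             ; (inj₂ (y∈F , x∉F , dX) , z∉F) → inj₂ (y∈F , x∉F , dX , λ k → z∉F (∈toX⁻ z≢x k)) })
        , (λ { (inj₁ (d , z∉F)) → inj₁ d , z∉F
             ; (inj₂ (y∈F , x∉F , dX , z∉X)) → inj₂ (y∈F , x∉F , dX) , λ k → z∉X (exchange⁺ k z≢y) })

      link-dup : link (dup Δ) z ≋ dup (link Δ z)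
      link-dup F = to , fr
        where
        to : link (dup Δ) z F → dup (link Δ z) F
        to (inj₁ d , z∉F , inj₁ d′) = inj₁ (d , z∉F , d′)
        to (inj₁ d , z∉F , inj₂ (y∈F∪z , _)) =
          ⊥-elim ([ ghost F d , (λ k → z≢y (sym (∈⁅⁆⁻ k))) ]′ (∈∪⁻ y∈F∪z))
        to (inj₂ (y∈F , _ , _) , _ , inj₁ d′) = ⊥-elim (ghost _ d′ (x∈p∪q⁺ (inj₁ y∈F)))
        to (inj₂ (y∈F , x∉F , dX) , z∉F , inj₂ (_ , _ , dXz)) =
          inj₂ (y∈F , x∉F , dX , (λ k → z∉F (∈toX⁻ z≢x k)) , subst Δ (toX-∪ z≢y) dXz)
        fr : dup (link Δ z) F → link (dup Δ) z F
        fr (inj₁ (d , z∉F , d′)) = inj₁ d , z∉F , inj₁ d′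
        fr (inj₂ (y∈F , x∉F , dX , z∉X , dXz)) =
          inj₂ (y∈F , x∉F , dX) , (λ k → z∉X (exchange⁺ k z≢y)) ,
          inj₂ (x∈p∪q⁺ (inj₁ y∈F) , x∉F∪z , subst Δ (sym (toX-∪ z≢y)) dXz)
          where
          x∉F∪z : x ∉ F ∪ ⁅ z ⁆
          x∉F∪z k = [ x∉F , (λ k′ → z≢x (sym (∈⁅⁆⁻ k′))) ]′ (∈∪⁻ k)

  singleton-dup : ∀ {Δ} → Δ ⁅ x ⁆ → dup Δ ⁅ y ⁆
  singleton-dup {Δ} d = inj₂ (x∈⁅x⁆ y , (λ k → x≢y (∈⁅⁆⁻ k)) , subst Δ (sym toX⁅y⁆) d)
    where
    toX⁅y⁆ : toX ⁅ y ⁆ ≡ ⁅ x ⁆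
    toX⁅y⁆ = begin
      toX ⁅ y ⁆       ≡⟨ cong toX (sym (∪-identityˡ ⁅ y ⁆)) ⟩
      toX (⊥ ∪ ⁅ y ⁆) ≡⟨ toX-∪y ∉⊥ ⟩
      ⊥ ∪ ⁅ x ⁆       ≡⟨ ∪-identityˡ ⁅ x ⁆ ⟩
      ⁅ x ⁆           ∎
      where open ≡-Reasoning

  -- By
  -- induction on the decomposition: a unique facet avoiding x stays unique; a
  -- unique facet through x, or a decomposition shedding x, is followed by
  -- shedding y (whose deletion is Δ and link is link Δ x); shedding any other
  -- vertex commutes with duplication.
  vd-dup : ∀ {Δ} → Ghost Δ y → DecidableFaces Δ → DownClosed Δ →
           VertexDecomposable Δ → VertexDecomposable (dup Δ)
  vd-dup {Δ} ghost dec down vdΔ@(vd-unique pure (F , fF , unique)) with x ∈? F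
  ... | no x∉F = vd-unique (unique⇒pure U) U
    where
    only : ∀ {G} → DupFacet ghost G → G ≡ F
    only (inj₁ (_ , f)) = unique _ f
    only (inj₂ (_ , _ , f)) = ⊥-elim (x∉F (subst (x ∈_) (unique _ f) x∈toX))
    U : UniqueFacet (dup Δ)
    U = F , facet-dup ghost fF , λ G fG → only (facet-dup⁻ ghost fG)
  ... | yes x∈F = vd-split (pure-dup ghost pure) y (singleton-dup {Δ} (down (⁅x⁆⊆ x∈F) (proj₁ fF)))
      (vd-≋ (≋-sym (del-dup-y ghost)) vdΔ)
      (vd-≋ (≋-sym (link-dup-y ghost)) (vd-unique (unique⇒pure UL) UL))
    where
    UL : UniqueFacet (link Δ x)
    UL = uniqueFacet-link dec down F fF unique x x∈F
    ⁅x⁆⊆ : ∀ {A} → x ∈ A → ⁅ x ⁆ ⊆ A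
    ⁅x⁆⊆ {A} x∈A k = subst (_∈ A) (sym (∈⁅⁆⁻ k)) x∈A
  vd-dup {Δ} ghost dec down vdΔ@(vd-split pure z dz vd vl) with z FinP.≟ x
  ... | yes refl = vd-split (pure-dup ghost pure) y (singleton-dup {Δ} dz)
      (vd-≋ (≋-sym (del-dup-y ghost)) vdΔ)
      (vd-≋ (≋-sym (link-dup-y ghost)) vl)
  ... | no z≢x = vd-split (pure-dup ghost pure) z (inj₁ dz)
      (vd-≋ (≋-sym (del-dup ghost z≢x z≢y))
            (vd-dup (λ F d → ghost F (proj₁ d)) (dec-del dec z) (down-del down z) vd))
      (vd-≋ (≋-sym (link-dup ghost z≢x z≢y))
            (vd-dup (λ F d → ghost F (proj₁ d)) (dec-link dec z) (down-link down z) vl))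
    where
    z≢y : z ≢ y
    z≢y refl = ghost _ dz (x∈⁅x⁆ z)

-- A shelling is kept as a list whose head is the
-- most recently added facet; each facet must meet every earlier facet G along a
-- vertex u ∉ G such that F ∖ {u} lies in some earlier facet H, i.e. F ∖ H = {u}.

AttachesTo : ∀ {n} → Subset n → List (Subset n) → Set
AttachesTo F L = ∀ G → G ∈L L → ∃ λ u → u ∈ F ─ G × ∃ λ H → H ∈L L × F ─ H ≡ ⁅ u ⁆

data ShellingList {n : ℕ} : List (Subset n) → Set where
  []  : ShellingList List.[]
  _∷_ : ∀ {F L} → AttachesTo F L → ShellingList L → ShellingList (F List.∷ L)

ListShellable : ∀ {n} → Complex n → Set
ListShellable {n} Δ = Pure Δ × Σ (List (Subset n)) λ L →
  ShellingList L × AllPairs _≢_ L × All (IsFacet Δ) L × (∀ F → IsFacet Δ F → F ∈L L)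

listShellable-≋ : ∀ {n} {Δ Δ′ : Complex n} → Δ ≋ Δ′ → ListShellable Δ → ListShellable Δ′
listShellable-≋ e (pure , L , shelling , distinct , facets , complete) =
  pure-≋ e pure , L , shelling , distinct , All.map (facet-≋ e) facets ,
  λ F f → complete F (facet-≋ (≋-sym e) f)

-- From a shelling F₀,…,F_{s-1} to a list: the reversed prefix F_{t-1},…,F₀.
module ShellingToList {n : ℕ} {Δ : Complex n} (s : ℕ) (F : Fin s → Subset n)
  (injective : ∀ i j → F i ≡ F j → i ≡ j)
  (shelling : ∀ i j → j Fin.< i →
     ∃ λ x → x ∈ (F i ─ F j) × ∃ λ k → k Fin.< i × (F i ─ F k ≡ ⁅ x ⁆)) where

  prefix : (t : ℕ) → t ≤ s → List (Subset n)
  prefix zero _ = List.[]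
  prefix (suc t) t<s = F (Fin.fromℕ< t<s) List.∷ prefix t (ℕP.<⇒≤ t<s)

  ∈prefix⁻ : ∀ {G} t t≤s → G ∈L prefix t t≤s → ∃ λ i → toℕ i < t × F i ≡ G
  ∈prefix⁻ (suc t) t<s (hereL refl) = _ , s≤s (ℕP.≤-reflexive (FinP.toℕ-fromℕ< t<s)) , refl
  ∈prefix⁻ (suc t) t<s (thereL m) with ∈prefix⁻ t (ℕP.<⇒≤ t<s) m
  ... | i , i<t , Fi≡G = i , ℕP.m≤n⇒m≤1+n i<t , Fi≡G

  ∈prefix⁺ : ∀ t t≤s i → toℕ i < t → F i ∈L prefix t t≤s
  ∈prefix⁺ (suc t) t<s i i<1+t with toℕ i ℕP.≟ t
  ... | yes i≡t = hereL (cong F (FinP.toℕ-injective (trans i≡t (sym (FinP.toℕ-fromℕ< t<s)))))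
  ... | no i≢t = thereL (∈prefix⁺ t (ℕP.<⇒≤ t<s) i (ℕP.≤∧≢⇒< (ℕ.s≤s⁻¹ i<1+t) i≢t))

  prefix-shelling : ∀ t t≤s → ShellingList (prefix t t≤s)
  prefix-shelling zero _ = []
  prefix-shelling (suc t) t<s = attaches ∷ prefix-shelling t (ℕP.<⇒≤ t<s)
    where
    i : Fin s
    i = Fin.fromℕ< t<s
    attaches : AttachesTo (F i) (prefix t (ℕP.<⇒≤ t<s))
    attaches G m with ∈prefix⁻ t _ m
    ... | j , j<t , refl with shelling i j (subst (toℕ j <_) (sym (FinP.toℕ-fromℕ< t<s)) j<t)
    ... | u , u∈Fi─Fj , k , k<i , Fi─Fk≡u =
      u , u∈Fi─Fj , F k , ∈prefix⁺ t _ k (subst (toℕ k <_) (FinP.toℕ-fromℕ< t<s) k<i) , Fi─Fk≡u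

  prefix-distinct : ∀ t t≤s → AllPairs _≢_ (prefix t t≤s)
  prefix-distinct zero _ = AllPairs.[]
  prefix-distinct (suc t) t<s = All.tabulate newest≢ AllPairs.∷ prefix-distinct t _
    where
    newest≢ : ∀ {G} → G ∈L prefix t (ℕP.<⇒≤ t<s) → F (Fin.fromℕ< t<s) ≢ G
    newest≢ m eq with ∈prefix⁻ t _ m
    ... | j , j<t , refl = ℕP.<-irrefl (trans (sym (cong toℕ (injective _ _ eq))) (FinP.toℕ-fromℕ< t<s)) j<t

shellable⇒listShellable : ∀ {n} {Δ : Complex n} → Shellable Δ → ListShellable Δ
shellable⇒listShellable {Δ = Δ} (pure , s , F , injective , facets , complete , shelling) =
  pure , prefix s ℕP.≤-refl , prefix-shelling s _ , prefix-distinct s _ ,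
  All.tabulate (λ m → facet (∈prefix⁻ s _ m)) , λ G fG → listed (complete G fG)
  where
  open ShellingToList {Δ = Δ} s F injective shelling
  facet : ∀ {G} → (∃ λ i → toℕ i < s × F i ≡ G) → IsFacet Δ G
  facet (i , _ , refl) = facets i
  listed : ∀ {G} → (∃ λ i → F i ≡ G) → G ∈L prefix s ℕP.≤-refl
  listed (i , refl) = ∈prefix⁺ s _ i (FinP.toℕ<n i)

module ListToShelling {n : ℕ} where

  private
    enumerate-∷ : (F : Subset n) (L : List (Subset n)) (i : Fin (suc (length L))) →
                  Dec (toℕ i ≡ length L) → (Fin (length L) → Subset n) → Subset n
    enumerate-∷ F L i (yes _) _ = F
    enumerate-∷ F L i (no i≢last) earlier = earlier (Fin.lower₁ i (λ e → i≢last (sym e)))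

  enumerate : (L : List (Subset n)) → Fin (length L) → Subset n
  enumerate (F List.∷ L) i = enumerate-∷ F L i (toℕ i ℕP.≟ length L) (enumerate L)

  enumerate-cases : ∀ F L i →
    (toℕ i ≡ length L × enumerate (F List.∷ L) i ≡ F) ⊎
    (Σ (Fin (length L)) λ i′ → toℕ i′ ≡ toℕ i × enumerate (F List.∷ L) i ≡ enumerate L i′)
  enumerate-cases F L i = cases (toℕ i ℕP.≟ length L)
    where
    cases : (d : Dec (toℕ i ≡ length L)) →
      (toℕ i ≡ length L × enumerate-∷ F L i d (enumerate L) ≡ F) ⊎
      (Σ (Fin (length L)) λ i′ → toℕ i′ ≡ toℕ i × enumerate-∷ F L i d (enumerate L) ≡ enumerate L i′)
    cases (yes i≡last) = inj₁ (i≡last , refl)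
    cases (no _) = inj₂ (_ , FinP.toℕ-lower₁ i _ , refl)

  enumerate-inject₁ : ∀ F L k → enumerate (F List.∷ L) (Fin.inject₁ k) ≡ enumerate L k
  enumerate-inject₁ F L k with enumerate-cases F L (Fin.inject₁ k)
  ... | inj₁ (k≡last , _) =
    ⊥-elim (ℕP.<-irrefl (trans (sym (FinP.toℕ-inject₁ k)) k≡last) (FinP.toℕ<n k))
  ... | inj₂ (k′ , k′≡k , eq) =
    trans eq (cong (enumerate L) (FinP.toℕ-injective (trans k′≡k (FinP.toℕ-inject₁ k))))

  enumerate-∈ : ∀ L i → enumerate L i ∈L L
  enumerate-∈ (F List.∷ L) i with enumerate-cases F L i
  ... | inj₁ (_ , eq) = hereL eq
  ... | inj₂ (i′ , _ , eq) = thereL (subst (_∈L L) (sym eq) (enumerate-∈ L i′))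

  enumerate-onto : ∀ L {G} → G ∈L L → ∃ λ i → enumerate L i ≡ G
  enumerate-onto (F List.∷ L) (hereL refl) with enumerate-cases F L (Fin.fromℕ (length L))
  ... | inj₁ (_ , eq) = Fin.fromℕ (length L) , eq
  ... | inj₂ (i′ , i′≡last , _) =
    ⊥-elim (ℕP.<-irrefl (trans i′≡last (FinP.toℕ-fromℕ _)) (FinP.toℕ<n i′))
  enumerate-onto (F List.∷ L) (thereL m) with enumerate-onto L m
  ... | i′ , eq = Fin.inject₁ i′ , trans (enumerate-inject₁ F L i′) eq

  enumerate-injective : ∀ L → AllPairs _≢_ L → ∀ i j → enumerate L i ≡ enumerate L j → i ≡ j
  enumerate-injective (F List.∷ L) (F∉L AllPairs.∷ distinct) i j eq
    with enumerate-cases F L i | enumerate-cases F L j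
  ... | inj₁ (i≡last , _) | inj₁ (j≡last , _) = FinP.toℕ-injective (trans i≡last (sym j≡last))
  ... | inj₁ (_ , ei) | inj₂ (j′ , _ , ej) =
    ⊥-elim (All.lookup F∉L (enumerate-∈ L j′) (trans (sym ei) (trans eq ej)))
  ... | inj₂ (i′ , _ , ei) | inj₁ (_ , ej) =
    ⊥-elim (All.lookup F∉L (enumerate-∈ L i′) (trans (sym ej) (trans (sym eq) ei)))
  ... | inj₂ (i′ , i′≡i , ei) | inj₂ (j′ , j′≡j , ej) =
    FinP.toℕ-injective (trans (sym i′≡i) (trans (cong toℕ i′≡j′) j′≡j))
    where
    i′≡j′ : i′ ≡ j′
    i′≡j′ = enumerate-injective L distinct i′ j′ (trans (sym ei) (trans eq ej))

  -- The shelling condition, by induction on the list: the newest facet uses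
  -- the list condition, an older one the induction hypothesis.
  enumerate-shelling : ∀ L → ShellingList L → ∀ i j → j Fin.< i →
    ∃ λ x → x ∈ (enumerate L i ─ enumerate L j) ×
            ∃ λ k → k Fin.< i × (enumerate L i ─ enumerate L k ≡ ⁅ x ⁆)
  enumerate-shelling (F List.∷ L) (attaches ∷ shelling) i j j<i
    with enumerate-cases F L i | enumerate-cases F L j
  ... | _ | inj₁ (j≡last , _) =
    ⊥-elim (ℕP.<-irrefl j≡last (ℕP.<-≤-trans j<i (ℕ.s≤s⁻¹ (FinP.toℕ<n i))))
  ... | inj₁ (i≡last , ei) | inj₂ (j′ , _ , ej) with attaches _ (enumerate-∈ L j′)
  ... | u , u∈F─Fj , H , H∈L , F─H≡u with enumerate-onto L H∈L
  ... | k′ , refl =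
    u , subst₂ (λ A B → u ∈ A ─ B) (sym ei) (sym ej) u∈F─Fj , Fin.inject₁ k′ ,
    subst (_< toℕ i) (sym (FinP.toℕ-inject₁ k′)) (subst (toℕ k′ <_) (sym i≡last) (FinP.toℕ<n k′)) ,
    trans (cong₂ _─_ ei (enumerate-inject₁ F L k′)) F─H≡u
  enumerate-shelling (F List.∷ L) (_ ∷ shelling) i j j<i
    | inj₂ (i′ , i′≡i , ei) | inj₂ (j′ , j′≡j , ej)
    with enumerate-shelling L shelling i′ j′ (subst₂ _<_ (sym j′≡j) (sym i′≡i) j<i)
  ... | u , u∈ , k′ , k′<i′ , eq =
    u , subst₂ (λ A B → u ∈ A ─ B) (sym ei) (sym ej) u∈ , Fin.inject₁ k′ ,
    subst₂ _<_ (sym (FinP.toℕ-inject₁ k′)) i′≡i k′<i′ ,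
    trans (cong₂ _─_ ei (enumerate-inject₁ F L k′)) eq

listShellable⇒shellable : ∀ {n} {Δ : Complex n} → ListShellable Δ → Shellable Δ
listShellable⇒shellable (pure , L , shelling , distinct , facets , complete) =
  pure , length L , enumerate L , enumerate-injective L distinct ,
  (λ i → All.lookup facets (enumerate-∈ L i)) ,
  (λ G fG → enumerate-onto L (complete G fG)) , enumerate-shelling L shelling
  where open ListToShelling

-- Duplicating a vertex into a ghost preserves shellability: the facets of
-- dup Δ are the facets L of Δ followed by the twins toY F of those F ∈ L
-- containing x, and the twins can be appended in the order of L.
module DuplicationShelling {n : ℕ} (x y : Fin n) (x≢y : x ≢ y) where
  open Duplication x y x≢y

  private
    twin-∷ : (F : Subset n) → Dec (x ∈ F) → List (Subset n) → List (Subset n)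
    twin-∷ F (yes _) rest = toY F List.∷ rest
    twin-∷ F (no _) rest = rest

  twins : List (Subset n) → List (Subset n)
  twins List.[] = List.[]
  twins (F List.∷ K) = twin-∷ F (x ∈? F) (twins K)

  ∈twins⁻ : ∀ {G} K → G ∈L twins K → ∃ λ G₀ → G₀ ∈L K × x ∈ G₀ × G ≡ toY G₀
  ∈twins⁻ (F List.∷ K) = step (x ∈? F)
    where
    step : ∀ {G} (d : Dec (x ∈ F)) → G ∈L twin-∷ F d (twins K) →
           ∃ λ G₀ → G₀ ∈L (F List.∷ K) × x ∈ G₀ × G ≡ toY G₀
    step (yes x∈F) (hereL refl) = F , hereL refl , x∈F , refl
    step (yes _) (thereL m) with ∈twins⁻ K m
    ... | G₀ , G₀∈K , x∈G₀ , eq = G₀ , thereL G₀∈K , x∈G₀ , eq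
    step (no _) m with ∈twins⁻ K m
    ... | G₀ , G₀∈K , x∈G₀ , eq = G₀ , thereL G₀∈K , x∈G₀ , eq

  ∈twins⁺ : ∀ {G₀} K → G₀ ∈L K → x ∈ G₀ → toY G₀ ∈L twins K
  ∈twins⁺ (F List.∷ K) G₀∈K x∈G₀ = step (x ∈? F) G₀∈K
    where
    step : (d : Dec (x ∈ F)) → _ ∈L (F List.∷ K) → toY _ ∈L twin-∷ F d (twins K)
    step (yes _) (hereL refl) = hereL refl
    step (yes _) (thereL m) = thereL (∈twins⁺ K m x∈G₀)
    step (no x∉F) (hereL refl) = ⊥-elim (x∉F x∈G₀)
    step (no _) (thereL m) = ∈twins⁺ K m x∈G₀

  -- The twin of F attaches to F itself along y ...
  toY─self : ∀ {F} → y ∉ F → x ∈ F → toY F ─ F ≡ ⁅ y ⁆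
  toY─self {F} y∉F x∈F = ⊆-antisym to fr
    where
    to : toY F ─ F ⊆ ⁅ y ⁆
    to m with exchange⁻ (proj₁ (∈─⁻ m))
    ... | inj₁ (u∈F , _) = ⊥-elim (proj₂ (∈─⁻ m) u∈F)
    ... | inj₂ u≡y = ∈⁅⁆⁺ u≡y
    fr : ⁅ y ⁆ ⊆ toY F ─ F
    fr m with ∈⁅⁆⁻ m
    ... | refl = x∈p∧x∉q⇒x∈p─q y∈toY y∉F

  -- ... and twins differ from each other as the original facets do.
  ∈toY─toY : ∀ {F G u} → y ∉ F → x ∈ G → u ∈ F ─ G → u ∈ toY F ─ toY G
  ∈toY─toY {F} {G} {u} y∉F x∈G m = x∈p∧x∉q⇒x∈p─q (exchange⁺ (proj₁ (∈─⁻ m)) u≢x) u∉toY-G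
    where
    u≢x : u ≢ x
    u≢x refl = proj₂ (∈─⁻ m) x∈G
    u∉toY-G : u ∉ toY G
    u∉toY-G k with exchange⁻ k
    ... | inj₁ (u∈G , _) = proj₂ (∈─⁻ m) u∈G
    ... | inj₂ refl = y∉F (proj₁ (∈─⁻ m))

  toY─toY : ∀ {F H u} → y ∉ F → x ∈ H → F ─ H ≡ ⁅ u ⁆ → toY F ─ toY H ≡ ⁅ u ⁆
  toY─toY {F} {H} {u} y∉F x∈H F─H≡u = ⊆-antisym to fr
    where
    to : toY F ─ toY H ⊆ ⁅ u ⁆
    to {v} m with exchange⁻ (proj₁ (∈─⁻ m))
    ... | inj₂ refl = ⊥-elim (proj₂ (∈─⁻ m) y∈toY)
    ... | inj₁ (v∈F , v≢x) =
      subst (v ∈_) F─H≡u (x∈p∧x∉q⇒x∈p─q v∈F (λ v∈H → proj₂ (∈─⁻ m) (exchange⁺ v∈H v≢x)))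
    fr : ⁅ u ⁆ ⊆ toY F ─ toY H
    fr {v} m with ∈⁅⁆⁻ m
    ... | refl = ∈toY─toY y∉F x∈H (subst (v ∈_) (sym F─H≡u) m)

  x∈H : ∀ {F H u} → x ∈ F → F ─ H ≡ ⁅ u ⁆ → u ≢ x → x ∈ H
  x∈H {F} {H} x∈F F─H≡u u≢x with x ∈? H
  ... | yes x∈H = x∈H
  ... | no x∉H = ⊥-elim (u≢x (sym (∈⁅⁆⁻ (subst (x ∈_) F─H≡u (x∈p∧x∉q⇒x∈p─q x∈F x∉H)))))

  module _ (L : List (Subset n)) (y∉L : ∀ G → G ∈L L → y ∉ G) (shellingL : ShellingList L) where

    twins-shelling : ∀ {K} → ShellingList K → (∀ G → G ∈L K → G ∈L L) → ShellingList (twins K ++ L)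
    twins-shelling [] _ = shellingL
    twins-shelling {F List.∷ K} (attaches ∷ shellingK) K⊆L = step (x ∈? F)
      where
      rest : ShellingList (twins K ++ L)
      rest = twins-shelling shellingK (λ G m → K⊆L G (thereL m))
      y∉F : y ∉ F
      y∉F = y∉L F (K⊆L F (hereL refl))
      step : (d : Dec (x ∈ F)) → ShellingList (twin-∷ F d (twins K) ++ L)
      step (no _) = rest
      step (yes x∈F) = attachesY ∷ rest
        where
        attachesY : AttachesTo (toY F) (twins K ++ L)
        attachesY G m with ∈-++⁻ (twins K) m
        ... | inj₂ G∈L =
          y , x∈p∧x∉q⇒x∈p─q y∈toY (y∉L G G∈L) , F , ∈-++⁺ʳ (twins K) (K⊆L F (hereL refl)) ,
          toY─self y∉F x∈F
        ... | inj₁ G∈twins with ∈twins⁻ K G∈twins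
        ... | G₀ , G₀∈K , x∈G₀ , refl with attaches G₀ G₀∈K
        ... | u , u∈F─G₀ , H , H∈K , F─H≡u =
          u , ∈toY─toY y∉F x∈G₀ u∈F─G₀ , toY H , ∈-++⁺ˡ (∈twins⁺ K H∈K x∈H′) , toY─toY y∉F x∈H′ F─H≡u
          where
          x∈H′ : x ∈ H
          x∈H′ = x∈H x∈F F─H≡u (λ { refl → proj₂ (∈─⁻ u∈F─G₀) x∈G₀ })

  twins-distinct : ∀ K → (∀ G → G ∈L K → y ∉ G) → AllPairs _≢_ K → AllPairs _≢_ (twins K)
  twins-distinct List.[] _ _ = AllPairs.[]
  twins-distinct (F List.∷ K) y∉K (F∉K AllPairs.∷ distinct) = step (x ∈? F)
    where
    rest : AllPairs _≢_ (twins K)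
    rest = twins-distinct K (λ G m → y∉K G (thereL m)) distinct
    step : (d : Dec (x ∈ F)) → AllPairs _≢_ (twin-∷ F d (twins K))
    step (no _) = rest
    step (yes x∈F) = All.tabulate toY-F≢ AllPairs.∷ rest
      where
      toY-F≢ : ∀ {G} → G ∈L twins K → toY F ≢ G
      toY-F≢ m eq with ∈twins⁻ K m
      ... | G₀ , G₀∈K , x∈G₀ , refl =
        All.lookup F∉K G₀∈K (trans (sym (toX-toY x∈F (y∉K F (hereL refl))))
                              (trans (cong toX eq) (toX-toY x∈G₀ (y∉K G₀ (thereL G₀∈K)))))

  listShellable-dup : ∀ {Δ} → Ghost Δ y → ListShellable Δ → ListShellable (dup Δ)
  listShellable-dup {Δ} ghost (pure , L , shelling , distinct , facets , complete) =
    pure-dup ghost pure , twins L ++ L ,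
    twins-shelling L y∉L shelling shelling (λ G m → m) ,
    AllPairsP.++⁺ (twins-distinct L y∉L distinct) distinct
                  (All.tabulate λ m → All.tabulate λ m′ eq → twin≢facet m m′ eq) ,
    All.tabulate facet , listed
    where
    y∉L : ∀ G → G ∈L L → y ∉ G
    y∉L G m = ghost G (proj₁ (All.lookup facets m))
    twin≢facet : ∀ {A B} → A ∈L twins L → B ∈L L → A ≢ B
    twin≢facet m m′ refl with ∈twins⁻ L m
    ... | _ , _ , _ , refl = y∉L _ m′ y∈toY
    facet : ∀ {G} → G ∈L twins L ++ L → IsFacet (dup Δ) G
    facet m with ∈-++⁻ (twins L) m
    ... | inj₂ G∈L = facet-dup ghost (All.lookup facets G∈L)
    ... | inj₁ G∈twins with ∈twins⁻ L G∈twins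
    ... | G₀ , G₀∈L , x∈G₀ , refl = facet-dupY ghost (All.lookup facets G₀∈L) x∈G₀
    listed : ∀ G → IsFacet (dup Δ) G → G ∈L twins L ++ L
    listed G f with facet-dup⁻ ghost f
    ... | inj₁ (_ , fΔ) = ∈-++⁺ʳ (twins L) (complete G fΔ)
    ... | inj₂ (y∈G , x∉G , fΔ) =
      ∈-++⁺ˡ (subst (_∈L twins L) (toY-toX y∈G x∉G) (∈twins⁺ L (complete _ fΔ) x∈toX))

setOf : ∀ {N} {P : Fin N → Set} → (∀ u → Dec (P u)) → Subset N
setOf P? = tabulate (λ u → does (P? u))

module _ {N : ℕ} {P : Fin N → Set} {P? : ∀ u → Dec (P u)} {u : Fin N} where

  ∈setOf⁻ : u ∈ setOf P? → P u
  ∈setOf⁻ m = witness (P? u) (trans (sym (lookup∘tabulate (λ w → does (P? w)) u)) ([]=⇒lookup m))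
    where
    witness : (d : Dec (P u)) → does d ≡ true → P u
    witness (yes p) _ = p

  ∈setOf⁺ : P u → u ∈ setOf P?
  ∈setOf⁺ p = lookup⇒[]= u (setOf P?) (trans (lookup∘tabulate (λ w → does (P? w)) u) (dec-true (P? u) p))

-- Faces
-- correspond via image/preimage, so vertex decomposability and shellability
-- carry over.
module Transport {n N : ℕ} (e : Fin n → Fin N) (e-injective : ∀ a b → e a ≡ e b → a ≡ b) where

  preimage : Subset N → Subset n
  preimage F = setOf (λ v → e v ∈? F)

  ∈preimage⁻ : ∀ {F v} → v ∈ preimage F → e v ∈ F
  ∈preimage⁻ {F} = ∈setOf⁻ {P? = λ v → e v ∈? F}

  ∈preimage⁺ : ∀ {F v} → e v ∈ F → v ∈ preimage F
  ∈preimage⁺ {F} = ∈setOf⁺ {P? = λ v → e v ∈? F}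

  InImage : Subset N → Set
  InImage F = ∀ u → u ∈ F → ∃ λ v → e v ≡ u

  transport : Complex n → Complex N
  transport Δ F = InImage F × Δ (preimage F)

  hit? : ∀ F u → Dec (∃ λ v → v ∈ F × e v ≡ u)
  hit? F u = FinP.any? (λ v → (v ∈? F) ×-dec (e v FinP.≟ u))

  image : Subset n → Subset N
  image F = setOf (hit? F)

  ∈image⁻ : ∀ {F u} → u ∈ image F → ∃ λ v → v ∈ F × e v ≡ u
  ∈image⁻ {F} = ∈setOf⁻ {P? = hit? F}

  ∈image⁺ : ∀ {F v} → v ∈ F → e v ∈ image F
  ∈image⁺ {F} v∈F = ∈setOf⁺ {P? = hit? F} (_ , v∈F , refl)

  inImage-image : ∀ {F} → InImage (image F)
  inImage-image u m with ∈image⁻ m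
  ... | v , _ , ev≡u = v , ev≡u

  preimage-image : ∀ {F} → preimage (image F) ≡ F
  preimage-image {F} = ⊆-antisym (λ m → fr (∈image⁻ (∈preimage⁻ m))) (λ m → ∈preimage⁺ (∈image⁺ m))
    where
    fr : ∀ {v} → (∃ λ w → w ∈ F × e w ≡ e v) → v ∈ F
    fr (w , w∈F , ew≡ev) = subst (_∈ F) (e-injective _ _ ew≡ev) w∈F

  image-preimage : ∀ {F} → InImage F → image (preimage F) ≡ F
  image-preimage {F} inImage = ⊆-antisym to fr
    where
    to : image (preimage F) ⊆ F
    to m with ∈image⁻ m
    ... | w , w∈ , refl = ∈preimage⁻ w∈
    fr : F ⊆ image (preimage F)
    fr {u} m with inImage u m
    ... | v , refl = ∈image⁺ (∈preimage⁺ m)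

  image-injective : ∀ {F G} → image F ≡ image G → F ≡ G
  image-injective eq = trans (sym preimage-image) (trans (cong preimage eq) preimage-image)

  preimage-⁅⁆ : ∀ v → preimage ⁅ e v ⁆ ≡ ⁅ v ⁆
  preimage-⁅⁆ v = ⊆-antisym (λ m → ∈⁅⁆⁺ (e-injective _ _ (∈⁅⁆⁻ (∈preimage⁻ m))))
                            (λ m → ∈preimage⁺ (∈⁅⁆⁺ (cong e (∈⁅⁆⁻ m))))

  image-⁅⁆ : ∀ v → image ⁅ v ⁆ ≡ ⁅ e v ⁆
  image-⁅⁆ v = trans (cong image (sym (preimage-⁅⁆ v))) (image-preimage (λ u m → v , sym (∈⁅⁆⁻ m)))

  preimage-∪ : ∀ F v → preimage (F ∪ ⁅ e v ⁆) ≡ preimage F ∪ ⁅ v ⁆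
  preimage-∪ F v = ⊆-antisym to fr
    where
    to : preimage (F ∪ ⁅ e v ⁆) ⊆ preimage F ∪ ⁅ v ⁆
    to m with ∈∪⁻ (∈preimage⁻ m)
    ... | inj₁ k = x∈p∪q⁺ (inj₁ (∈preimage⁺ k))
    ... | inj₂ k = x∈p∪q⁺ (inj₂ (∈⁅⁆⁺ (e-injective _ _ (∈⁅⁆⁻ k))))
    fr : preimage F ∪ ⁅ v ⁆ ⊆ preimage (F ∪ ⁅ e v ⁆)
    fr m with ∈∪⁻ m
    ... | inj₁ k = ∈preimage⁺ (x∈p∪q⁺ (inj₁ (∈preimage⁻ k)))
    ... | inj₂ k = ∈preimage⁺ (x∈p∪q⁺ (inj₂ (∈⁅⁆⁺ (cong e (∈⁅⁆⁻ k)))))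

  preimage-─ : ∀ F v → preimage (F ─ ⁅ e v ⁆) ≡ preimage F ─ ⁅ v ⁆
  preimage-─ F v = ⊆-antisym to fr
    where
    to : preimage (F ─ ⁅ e v ⁆) ⊆ preimage F ─ ⁅ v ⁆
    to m with ∈─⁻ (∈preimage⁻ m)
    ... | eu∈F , eu∉ = x∈p∧x∉q⇒x∈p─q (∈preimage⁺ eu∈F) (λ k → eu∉ (∈⁅⁆⁺ (cong e (∈⁅⁆⁻ k))))
    fr : preimage F ─ ⁅ v ⁆ ⊆ preimage (F ─ ⁅ e v ⁆)
    fr m with ∈─⁻ m
    ... | u∈ , u∉ = ∈preimage⁺ (x∈p∧x∉q⇒x∈p─q (∈preimage⁻ u∈) (λ k → u∉ (∈⁅⁆⁺ (e-injective _ _ (∈⁅⁆⁻ k)))))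

  image-─ : ∀ F G → image (F ─ G) ≡ image F ─ image G
  image-─ F G = ⊆-antisym to fr
    where
    to : image (F ─ G) ⊆ image F ─ image G
    to m with ∈image⁻ m
    ... | v , v∈F─G , refl = x∈p∧x∉q⇒x∈p─q (∈image⁺ (proj₁ (∈─⁻ v∈F─G))) ev∉
      where
      ev∉ : e v ∉ image G
      ev∉ k with ∈image⁻ k
      ... | w , w∈G , ew≡ev = proj₂ (∈─⁻ v∈F─G) (subst (_∈ G) (e-injective _ _ ew≡ev) w∈G)
    fr : image F ─ image G ⊆ image (F ─ G)
    fr m with ∈image⁻ (proj₁ (∈─⁻ m))
    ... | v , v∈F , refl = ∈image⁺ (x∈p∧x∉q⇒x∈p─q v∈F (λ v∈G → proj₂ (∈─⁻ m) (∈image⁺ v∈G)))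

  ∣preimage∣ : ∀ F → InImage F → ∣ preimage F ∣ ≡ ∣ F ∣
  ∣preimage∣ F = go ∣ F ∣ F refl
    where
    go : ∀ k F → ∣ F ∣ ≡ k → InImage F → ∣ preimage F ∣ ≡ ∣ F ∣
    go k F _ _ with nonempty? F
    go k F _ _ | no empty = begin
      ∣ preimage F ∣ ≡⟨ cong ∣_∣ (Empty-unique (λ { (v , m) → empty (e v , ∈preimage⁻ m) })) ⟩
      ∣ ⊥ {n} ∣      ≡⟨ trans (∣⊥∣≡0 n) (sym (∣⊥∣≡0 N)) ⟩
      ∣ ⊥ {N} ∣      ≡⟨ cong ∣_∣ (sym (Empty-unique empty)) ⟩
      ∣ F ∣          ∎
      where open ≡-Reasoning
    go zero F ∣F∣≡0 _ | yes (u , u∈F) = ⊥-elim (ℕP.1+n≢0 (trans (sym (∣p∣≡1+∣p─x∣ u F u∈F)) ∣F∣≡0))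
    go (suc k) F ∣F∣≡1+k inImage | yes (u , u∈F) with inImage u u∈F
    ... | v , refl = begin
      ∣ preimage F ∣                    ≡⟨ ∣p∣≡1+∣p─x∣ v (preimage F) (∈preimage⁺ u∈F) ⟩
      suc ∣ preimage F ─ ⁅ v ⁆ ∣        ≡⟨ cong (λ A → suc ∣ A ∣) (sym (preimage-─ F v)) ⟩
      suc ∣ preimage (F ─ ⁅ e v ⁆) ∣    ≡⟨ cong suc (go k (F ─ ⁅ e v ⁆) ∣F─ev∣≡k inImage′) ⟩
      suc ∣ F ─ ⁅ e v ⁆ ∣               ≡⟨ sym (∣p∣≡1+∣p─x∣ (e v) F u∈F) ⟩
      ∣ F ∣                             ∎
      where
      open ≡-Reasoning
      ∣F─ev∣≡k : ∣ F ─ ⁅ e v ⁆ ∣ ≡ k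
      ∣F─ev∣≡k = ℕP.suc-injective (trans (sym (∣p∣≡1+∣p─x∣ (e v) F u∈F)) ∣F∣≡1+k)
      inImage′ : InImage (F ─ ⁅ e v ⁆)
      inImage′ w m = inImage w (proj₁ (∈─⁻ m))

  module _ {Δ : Complex n} where

    facet-transport : ∀ {F} → IsFacet Δ F → IsFacet (transport Δ) (image F)
    facet-transport {F} (d , maximal) = (inImage-image , subst Δ (sym preimage-image) d) , maximal′
      where
      maximal′ : ∀ H → transport Δ H → image F ⊆ H → image F ≡ H
      maximal′ H (inImage , dH) sub =
        trans (cong image (maximal _ dH (λ m → ∈preimage⁺ (sub (∈image⁺ m))))) (image-preimage inImage)

    facet-transport⁻ : ∀ {G} → IsFacet (transport Δ) G → IsFacet Δ (preimage G)
    facet-transport⁻ {G} ((inImage , dG) , maximal) = dG , maximal′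
      where
      maximal′ : ∀ H → Δ H → preimage G ⊆ H → preimage G ≡ H
      maximal′ H dH sub =
        trans (cong preimage (maximal _ (inImage-image , subst Δ (sym preimage-image) dH) G⊆image-H))
              preimage-image
        where
        G⊆image-H : G ⊆ image H
        G⊆image-H {u} m with inImage u m
        ... | v , refl = ∈image⁺ (sub (∈preimage⁺ m))

    pure-transport : Pure Δ → Pure (transport Δ)
    pure-transport pure G G′ f f′ =
      trans (sym (∣preimage∣ G (proj₁ (proj₁ f))))
        (trans (pure _ _ (facet-transport⁻ f) (facet-transport⁻ f′)) (∣preimage∣ G′ (proj₁ (proj₁ f′))))

    uniqueFacet-transport : UniqueFacet Δ → UniqueFacet (transport Δ)
    uniqueFacet-transport (F , f , unique) =
      image F , facet-transport f ,
      λ G fG → trans (sym (image-preimage (proj₁ (proj₁ fG)))) (cong image (unique _ (facet-transport⁻ fG)))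

    del-transport : ∀ v → del (transport Δ) (e v) ≋ transport (del Δ v)
    del-transport v F = (λ { ((inImage , d) , ev∉F) → inImage , d , λ k → ev∉F (∈preimage⁻ k) })
                      , (λ { (inImage , d , v∉) → (inImage , d) , λ k → v∉ (∈preimage⁺ k) })

    link-transport : ∀ v → link (transport Δ) (e v) ≋ transport (link Δ v)
    link-transport v F =
        (λ { ((inImage , d) , ev∉F , (_ , d′)) →
               inImage , d , (λ k → ev∉F (∈preimage⁻ k)) , subst Δ (preimage-∪ F v) d′ })
      , (λ { (inImage , d , v∉ , d′) →
               (inImage , d) , (λ k → v∉ (∈preimage⁺ k)) ,
               (inImage-∪ inImage , subst Δ (sym (preimage-∪ F v)) d′) })
      where
      inImage-∪ : InImage F → InImage (F ∪ ⁅ e v ⁆)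
      inImage-∪ inImage u m = [ inImage u , (λ k → v , sym (∈⁅⁆⁻ k)) ]′ (∈∪⁻ m)

  vd-transport : ∀ {Δ} → VertexDecomposable Δ → VertexDecomposable (transport Δ)
  vd-transport {Δ} (vd-unique p u) = vd-unique (pure-transport {Δ} p) (uniqueFacet-transport {Δ} u)
  vd-transport {Δ} (vd-split p v d vd vl) =
    vd-split (pure-transport {Δ} p) (e v) ((λ u m → v , sym (∈⁅⁆⁻ m)) , subst Δ (sym (preimage-⁅⁆ v)) d)
      (vd-≋ (≋-sym (del-transport {Δ} v)) (vd-transport vd))
      (vd-≋ (≋-sym (link-transport {Δ} v)) (vd-transport vl))

  shellingList-image : ∀ {L} → ShellingList L → ShellingList (map image L)
  shellingList-image [] = []
  shellingList-image {F List.∷ L} (attaches ∷ shelling) = attaches′ ∷ shellingList-image shelling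
    where
    attaches′ : AttachesTo (image F) (map image L)
    attaches′ G m with ∈-map⁻ image m
    ... | G₀ , G₀∈L , refl with attaches G₀ G₀∈L
    ... | u , u∈F─G₀ , H , H∈L , F─H≡u =
      e u , subst (e u ∈_) (image-─ F G₀) (∈image⁺ u∈F─G₀) , image H , ∈-map⁺ image H∈L ,
      trans (sym (image-─ F H)) (trans (cong image F─H≡u) (image-⁅⁆ u))

  listShellable-transport : ∀ {Δ} → ListShellable Δ → ListShellable (transport Δ)
  listShellable-transport {Δ} (pure , L , shelling , distinct , facets , complete) =
    pure-transport {Δ} pure , map image L , shellingList-image shelling ,
    AllPairsP.map⁺ (AllPairs.map (λ F≢G eq → F≢G (image-injective eq)) distinct) ,
    All.tabulate (λ m → facet (∈-map⁻ image m)) ,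
    λ G fG → subst (_∈L map image L) (image-preimage (proj₁ (proj₁ fG)))
                   (∈-map⁺ image (complete _ (facet-transport⁻ {Δ} fG)))
    where
    facet : ∀ {G} → (∃ λ G₀ → G₀ ∈L L × G ≡ image G₀) → IsFacet (transport Δ) G
    facet (G₀ , m , refl) = facet-transport {Δ} (All.lookup facets m)

-- Independent sets of H contained in A, i.e. Ind(H[A]).
IndOn : (H : Graph) → Subset (size H) → Complex (size H)
IndOn H A F = F ⊆ A × Ind H F

Twins : (H : Graph) → Fin (size H) → Fin (size H) → Set
Twins H x y = ∀ z → z ≢ x → z ≢ y → (Adj H z x ⇔ Adj H z y) × (Adj H x z ⇔ Adj H y z)

module InducedSubgraphs (H : Graph) (adj? : ∀ a b → Dec (Adj H a b)) (irrefl : ∀ u → ¬ Adj H u u) where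

  dec-IndOn : ∀ A → DecidableFaces (IndOn H A)
  dec-IndOn A F = F ⊆? A
    ×-dec (FinP.all? λ a → FinP.all? λ b → (a ∈? F) →-dec (b ∈? F) →-dec (adj? a b →-dec no (λ z → z)))

  down-IndOn : ∀ A → DownClosed (IndOn H A)
  down-IndOn A G⊆F (F⊆A , ind) = (λ m → F⊆A (G⊆F m)) , λ a b ma mb → ind a b (G⊆F ma) (G⊆F mb)

  module AddTwin (A : Subset (size H)) (x y : Fin (size H)) (x≢y : x ≢ y) (y∉A : y ∉ A) (x∈A : x ∈ A)
                 (x~y : Adj H x y) (twins : Twins H x y) where
    open Duplication x y x≢y

    ghost-y : Ghost (IndOn H A) y
    ghost-y F (F⊆A , _) y∈F = y∉A (F⊆A y∈F)

    z~x⇒z~y : ∀ {z} → z ≢ x → z ≢ y → Adj H z x → Adj H z y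
    z~x⇒z~y z≢x z≢y = Equivalence.to (proj₁ (twins _ z≢x z≢y))
    z~y⇒z~x : ∀ {z} → z ≢ x → z ≢ y → Adj H z y → Adj H z x
    z~y⇒z~x z≢x z≢y = Equivalence.from (proj₁ (twins _ z≢x z≢y))
    x~z⇒y~z : ∀ {z} → z ≢ x → z ≢ y → Adj H x z → Adj H y z
    x~z⇒y~z z≢x z≢y = Equivalence.to (proj₂ (twins _ z≢x z≢y))
    y~z⇒x~z : ∀ {z} → z ≢ x → z ≢ y → Adj H y z → Adj H x z
    y~z⇒x~z z≢x z≢y = Equivalence.from (proj₂ (twins _ z≢x z≢y))

    toX-independent : ∀ {F} → F ⊆ A ∪ ⁅ y ⁆ → Ind H F → y ∈ F → IndOn H A (toX F)
    toX-independent {F} F⊆ ind y∈F = toX⊆A , ind′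
      where
      x∉F : x ∉ F
      x∉F x∈F = ind x y x∈F y∈F x~y
      toX⊆A : toX F ⊆ A
      toX⊆A m with exchange⁻ m
      ... | inj₂ refl = x∈A
      ... | inj₁ (u∈F , u≢y) = [ (λ k → k) , (λ k → ⊥-elim (u≢y (∈⁅⁆⁻ k))) ]′ (∈∪⁻ (F⊆ u∈F))
      ind′ : Ind H (toX F)
      ind′ a b ma mb with exchange⁻ ma | exchange⁻ mb
      ... | inj₁ (a∈F , _) | inj₁ (b∈F , _) = ind a b a∈F b∈F
      ... | inj₁ (a∈F , a≢y) | inj₂ refl = λ a~x → ind a y a∈F y∈F (z~x⇒z~y (λ { refl → x∉F a∈F }) a≢y a~x)
      ... | inj₂ refl | inj₁ (b∈F , b≢y) = λ x~b → ind y b y∈F b∈F (x~z⇒y~z (λ { refl → x∉F b∈F }) b≢y x~b)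
      ... | inj₂ refl | inj₂ refl = irrefl x

    toX-independent⁻ : ∀ {F} → x ∉ F → Ind H (toX F) → Ind H F
    toX-independent⁻ {F} x∉F ind a b ma mb with a FinP.≟ y | b FinP.≟ y
    ... | yes refl | yes refl = irrefl y
    ... | yes refl | no b≢y = λ y~b →
      ind x b x∈toX (exchange⁺ mb b≢y) (y~z⇒x~z (λ { refl → x∉F mb }) b≢y y~b)
    ... | no a≢y | yes refl = λ a~y →
      ind a x (exchange⁺ ma a≢y) x∈toX (z~y⇒z~x (λ { refl → x∉F ma }) a≢y a~y)
    ... | no a≢y | no b≢y = ind a b (exchange⁺ ma a≢y) (exchange⁺ mb b≢y)

    addTwin : IndOn H (A ∪ ⁅ y ⁆) ≋ dup (IndOn H A)
    addTwin F = to , fr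
      where
      to : IndOn H (A ∪ ⁅ y ⁆) F → dup (IndOn H A) F
      to (F⊆ , ind) with y ∈? F
      ... | no y∉F = inj₁ (F⊆A , ind)
        where
        F⊆A : F ⊆ A
        F⊆A m = [ (λ k → k) , (λ k → ⊥-elim (y∉F (subst (_∈ F) (∈⁅⁆⁻ k) m))) ]′ (∈∪⁻ (F⊆ m))
      ... | yes y∈F = inj₂ (y∈F , (λ x∈F → ind x y x∈F y∈F x~y) , toX-independent F⊆ ind y∈F)
      fr : dup (IndOn H A) F → IndOn H (A ∪ ⁅ y ⁆) F
      fr (inj₁ (F⊆A , ind)) = (λ m → x∈p∪q⁺ (inj₁ (F⊆A m))) , ind
      fr (inj₂ (_ , x∉F , toX⊆A , ind)) = F⊆ , toX-independent⁻ x∉F ind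
        where
        F⊆ : F ⊆ A ∪ ⁅ y ⁆
        F⊆ {u} m with u FinP.≟ y
        ... | yes u≡y = x∈p∪q⁺ (inj₂ (∈⁅⁆⁺ u≡y))
        ... | no u≢y = x∈p∪q⁺ (inj₁ (toX⊆A (exchange⁺ m u≢y)))

    vd-addTwin : VertexDecomposable (IndOn H A) → VertexDecomposable (IndOn H (A ∪ ⁅ y ⁆))
    vd-addTwin vd = vd-≋ (≋-sym addTwin) (vd-dup ghost-y (dec-IndOn A) (down-IndOn A) vd)

    listShellable-addTwin : ListShellable (IndOn H A) → ListShellable (IndOn H (A ∪ ⁅ y ⁆))
    listShellable-addTwin sh =
      listShellable-≋ (≋-sym addTwin) (DuplicationShelling.listShellable-dup x y x≢y ghost-y sh)

module LexicographicProduct (G : Graph) (adj? : ∀ a b → Dec (Adj G a b)) (irrefl : ∀ a → ¬ Adj G a a)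
                            (m′ : ℕ) where

  m n N : ℕ
  m = suc m′
  n = size G
  N = n * m

  H : Graph
  H = Lex G (K m)

  base : Fin N → Fin n
  base u = proj₁ (Fin.remQuot {n} m u)
  copy : Fin N → Fin m
  copy u = proj₂ (Fin.remQuot {n} m u)

  vertex-≡ : ∀ a b → base a ≡ base b → copy a ≡ copy b → a ≡ b
  vertex-≡ a b ba≡bb ca≡cb = trans (sym (FinP.combine-remQuot {n} m a))
    (trans (cong₂ Fin.combine ba≡bb ca≡cb) (FinP.combine-remQuot {n} m b))

  adjH? : ∀ a b → Dec (Adj H a b)
  adjH? a b with adj? (base a) (base b) | base a FinP.≟ base b | copy a FinP.≟ copy b
  ... | yes a~b | _ | _ = yes (inj₁ a~b)
  ... | no _ | yes ba≡bb | no ca≢cb = yes (inj₂ (ba≡bb , ca≢cb))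
  ... | no ¬a~b | no ba≢bb | _ = no λ { (inj₁ k) → ¬a~b k ; (inj₂ (k , _)) → ba≢bb k }
  ... | no ¬a~b | yes _ | yes ca≡cb = no λ { (inj₁ k) → ¬a~b k ; (inj₂ (_ , k)) → k ca≡cb }

  irreflH : ∀ u → ¬ Adj H u u
  irreflH u (inj₁ k) = irrefl (base u) k
  irreflH u (inj₂ (_ , k)) = k refl

  sameBase⇒twins : ∀ {x y} → base x ≡ base y → Twins H x y
  sameBase⇒twins {x} {y} bx≡by z z≢x z≢y = mk⇔ (into bx≡by z≢y) (into (sym bx≡by) z≢x)
                                          , mk⇔ (out bx≡by z≢y) (out (sym bx≡by) z≢x)
    where
    into : ∀ {x y} → base x ≡ base y → z ≢ y → Adj H z x → Adj H z y
    into bx≡by _ (inj₁ z~x) = inj₁ (subst (Adj G (base z)) bx≡by z~x)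
    into {x} {y} bx≡by z≢y (inj₂ (bz≡bx , _)) =
      inj₂ (trans bz≡bx bx≡by , λ cz≡cy → z≢y (vertex-≡ z y (trans bz≡bx bx≡by) cz≡cy))
    out : ∀ {x y} → base x ≡ base y → z ≢ y → Adj H x z → Adj H y z
    out bx≡by _ (inj₁ x~z) = inj₁ (subst (λ w → Adj G w (base z)) bx≡by x~z)
    out {x} {y} bx≡by z≢y (inj₂ (bx≡bz , _)) =
      inj₂ (trans (sym bx≡by) bx≡bz , λ cy≡cz → z≢y (sym (vertex-≡ y z (trans (sym bx≡by) bx≡bz) cy≡cz)))

  zeroth : Fin n → Fin N
  zeroth v = Fin.combine v Fin.zero

  zeroth-injective : ∀ a b → zeroth a ≡ zeroth b → a ≡ b
  zeroth-injective a b eq = FinP.combine-injectiveˡ a Fin.zero b Fin.zero eq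

  base-zeroth : ∀ v → base (zeroth v) ≡ v
  base-zeroth v = cong proj₁ (FinP.remQuot-combine {n} {m} v Fin.zero)
  copy-zeroth : ∀ v → copy (zeroth v) ≡ Fin.zero
  copy-zeroth v = cong proj₂ (FinP.remQuot-combine {n} {m} v Fin.zero)

  open InducedSubgraphs H adjH? irreflH
  open Transport zeroth zeroth-injective

  InStage : ℕ → Fin N → Set
  InStage t u = copy u ≡ Fin.zero ⊎ toℕ u < t

  inStage? : ∀ t u → Dec (InStage t u)
  inStage? t u with copy u FinP.≟ Fin.zero | toℕ u ℕP.<? t
  ... | yes c≡0 | _ = yes (inj₁ c≡0)
  ... | no _ | yes u<t = yes (inj₂ u<t)
  ... | no c≢0 | no u≮t = no λ { (inj₁ k) → c≢0 k ; (inj₂ k) → u≮t k }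

  stage : ℕ → Subset N
  stage t = setOf (inStage? t)

  ∈stage⁻ : ∀ {t u} → u ∈ stage t → InStage t u
  ∈stage⁻ {t} = ∈setOf⁻ {P? = inStage? t}
  ∈stage⁺ : ∀ {t u} → InStage t u → u ∈ stage t
  ∈stage⁺ {t} = ∈setOf⁺ {P? = inStage? t}

  initialStage : IndOn H (stage 0) ≋ transport (Ind G)
  initialStage F = to , fr
    where
    to : IndOn H (stage 0) F → transport (Ind G) F
    to (F⊆ , ind) = inImage , indG
      where
      inImage : InImage F
      inImage u m with ∈stage⁻ (F⊆ m)
      ... | inj₁ c≡0 = base u , vertex-≡ _ _ (base-zeroth (base u)) (trans (copy-zeroth (base u)) (sym c≡0))
      indG : Ind G (preimage F)
      indG a b ma mb a~b = ind (zeroth a) (zeroth b) (∈preimage⁻ ma) (∈preimage⁻ mb)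
        (inj₁ (subst₂ (Adj G) (sym (base-zeroth a)) (sym (base-zeroth b)) a~b))
    fr : transport (Ind G) F → IndOn H (stage 0) F
    fr (inImage , indG) = F⊆ , ind
      where
      F⊆ : F ⊆ stage 0
      F⊆ {u} m with inImage u m
      ... | v , refl = ∈stage⁺ (inj₁ (copy-zeroth v))
      ind : Ind H F
      ind a b ma mb a~b with inImage a ma | inImage b mb
      ... | v , refl | w , refl with a~b
      ... | inj₁ k =
        indG v w (∈preimage⁺ ma) (∈preimage⁺ mb) (subst₂ (Adj G) (base-zeroth v) (base-zeroth w) k)
      ... | inj₂ (_ , k) = k (trans (copy-zeroth v) (sym (copy-zeroth w)))

  finalStage : IndOn H (stage N) ≋ Ind H
  finalStage F = proj₂ , λ ind → (λ {u} _ → ∈stage⁺ (inj₂ (FinP.toℕ<n u))) , ind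

  stage-suc : ∀ t (t<N : t < N) → stage (suc t) ≡ stage t ∪ ⁅ Fin.fromℕ< t<N ⁆
  stage-suc t t<N = ⊆-antisym to fr
    where
    y : Fin N
    y = Fin.fromℕ< t<N
    to : stage (suc t) ⊆ stage t ∪ ⁅ y ⁆
    to {u} m with ∈stage⁻ m
    ... | inj₁ c≡0 = x∈p∪q⁺ (inj₁ (∈stage⁺ (inj₁ c≡0)))
    ... | inj₂ u<1+t with toℕ u ℕP.≟ t
    ... | no u≢t = x∈p∪q⁺ (inj₁ (∈stage⁺ (inj₂ (ℕP.≤∧≢⇒< (ℕ.s≤s⁻¹ u<1+t) u≢t))))
    ... | yes u≡t = x∈p∪q⁺ (inj₂ (∈⁅⁆⁺ (FinP.toℕ-injective (trans u≡t (sym (FinP.toℕ-fromℕ< t<N))))))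
    fr : stage t ∪ ⁅ y ⁆ ⊆ stage (suc t)
    fr m with ∈∪⁻ m
    ... | inj₂ k with ∈⁅⁆⁻ k
    ... | refl = ∈stage⁺ (inj₂ (s≤s (ℕP.≤-reflexive (FinP.toℕ-fromℕ< t<N))))
    fr m | inj₁ k with ∈stage⁻ k
    ... | inj₁ c≡0 = ∈stage⁺ (inj₁ c≡0)
    ... | inj₂ u<t = ∈stage⁺ (inj₂ (ℕP.m≤n⇒m≤1+n u<t))

  -- Any property of complexes preserved by adding twins passes from stage 0 to
  -- stage N: the vertex y of index t is either a copy 0, already present, or a
  -- twin of x = zeroth (base y), which is present and adjacent to y.
  module _ {ℓ} (P : Complex N → Set ℓ)
    (P-addTwin : ∀ A x y → x ≢ y → y ∉ A → x ∈ A → Adj H x y → Twins H x y →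
                 P (IndOn H A) → P (IndOn H (A ∪ ⁅ y ⁆))) where

    P-stage-suc : ∀ t (t<N : t < N) → P (IndOn H (stage t)) → P (IndOn H (stage (suc t)))
    P-stage-suc t t<N p =
      subst (λ A → P (IndOn H A)) (sym (stage-suc t t<N)) (add (copy y FinP.≟ Fin.zero))
      where
      y : Fin N
      y = Fin.fromℕ< t<N
      add : Dec (copy y ≡ Fin.zero) → P (IndOn H (stage t ∪ ⁅ y ⁆))
      add (yes c≡0) = subst (λ A → P (IndOn H A)) (sym stage∪y≡stage) p
        where
        y∈ : y ∈ stage t
        y∈ = ∈stage⁺ (inj₁ c≡0)
        stage∪y≡stage : stage t ∪ ⁅ y ⁆ ≡ stage t
        stage∪y≡stage =
          ⊆-antisym (λ m → [ (λ k → k) , (λ k → subst (_∈ stage t) (sym (∈⁅⁆⁻ k)) y∈) ]′ (∈∪⁻ m))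
                    (λ m → x∈p∪q⁺ (inj₁ m))
      add (no c≢0) = P-addTwin (stage t) x y x≢y y∉ x∈ x~y (sameBase⇒twins (base-zeroth (base y))) p
        where
        x : Fin N
        x = zeroth (base y)
        x≢y : x ≢ y
        x≢y eq = c≢0 (trans (cong copy (sym eq)) (copy-zeroth (base y)))
        y∉ : y ∉ stage t
        y∉ k = [ c≢0 , ℕP.<-irrefl (FinP.toℕ-fromℕ< t<N) ]′ (∈stage⁻ k)
        x∈ : x ∈ stage t
        x∈ = ∈stage⁺ (inj₁ (copy-zeroth (base y)))
        x~y : Adj H x y
        x~y = inj₂ (base-zeroth (base y) , λ cx≡cy → c≢0 (trans (sym cx≡cy) (copy-zeroth (base y))))

    P-stages : P (IndOn H (stage 0)) → ∀ t → t ≤ N → P (IndOn H (stage t))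
    P-stages p zero _ = p
    P-stages p (suc t) t<N = P-stage-suc t t<N (P-stages p t (ℕP.<⇒≤ t<N))

  vd-lex : VertexDecomposable (Ind G) → VertexDecomposable (Ind H)
  vd-lex vd = vd-≋ finalStage
    (P-stages VertexDecomposable
      (λ A x y x≢y y∉A x∈A x~y twins → AddTwin.vd-addTwin A x y x≢y y∉A x∈A x~y twins)
      (vd-≋ (≋-sym initialStage) (vd-transport vd)) N ℕP.≤-refl)

  shellable-lex : Shellable (Ind G) → Shellable (Ind H)
  shellable-lex sh = listShellable⇒shellable (listShellable-≋ finalStage
    (P-stages ListShellable
      (λ A x y x≢y y∉A x∈A x~y twins → AddTwin.listShellable-addTwin A x y x≢y y∉A x∈A x~y twins)
      (listShellable-≋ (≋-sym initialStage) (listShellable-transport (shellable⇒listShellable sh)))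
      N ℕP.≤-refl))

_∈ℕ?_ : (d : ℕ) (S : List ℕ) → Dec (d ∈L S)
d ∈ℕ? S = ListDec._∈?_ ℕP._≟_ d S

module CirculantAdjacency (G : Graph) (k : ℕ) (S : List ℕ) (1≤k : 1 ≤ k)
  (bounds : All (λ s → 1 ≤ s × s ≤ k ℕ./ 2) S) (iso : G ≅ Circ k S) where

  τ : Fin (size G) → Fin k
  τ = Inverse.to (proj₁ iso)

  adj? : ∀ a b → Dec (Adj G a b)
  adj? a b with ℕ.∣ toℕ (τ a) - toℕ (τ b) ∣ ∈ℕ? S | (k ∸ ℕ.∣ toℕ (τ a) - toℕ (τ b) ∣) ∈ℕ? S
  ... | yes d∈S | _ = yes (Equivalence.from (proj₂ iso a b) (inj₁ d∈S))
  ... | no _ | yes k-d∈S = yes (Equivalence.from (proj₂ iso a b) (inj₂ k-d∈S))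
  ... | no d∉S | no k-d∉S = no λ a~b → [ d∉S , k-d∉S ]′ (Equivalence.to (proj₂ iso a b) a~b)

  -- A loop would need 0 ∈ S or k ∈ S, but 1 ≤ s ≤ k/2 < k for s ∈ S.
  irrefl : ∀ a → ¬ Adj G a a
  irrefl a a~a with Equivalence.to (proj₂ iso a a) a~a
  ... | inj₁ 0∈S = 0∉S (subst (_∈L S) (ℕP.m≡n⇒∣m-n∣≡0 {toℕ (τ a)} refl) 0∈S)
    where
    0∉S : ¬ (0 ∈L S)
    0∉S m with All.lookup bounds m
    ... | () , _
  ... | inj₂ k∈S = k∉S 1≤k (subst (_∈L S) (cong (k ∸_) (ℕP.m≡n⇒∣m-n∣≡0 {toℕ (τ a)} refl)) k∈S)
    where
    k∉S : 1 ≤ k → ¬ (k ∈L S)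
    k∉S (s≤s {n = k′} z≤n) m = ℕP.<-irrefl refl (ℕP.≤-<-trans (proj₂ (All.lookup bounds m))
                                                              (DM.m/n<m (suc k′) 2 (s≤s (s≤s z≤n))))

-- Arithmetic modulo k = suc p for the circulant C_k(S).  Positions at distance
-- δ < k (measured one way round) are "near" if they are equal or adjacent.
module CirculantArithmetic (p : ℕ) (S : List ℕ) where

  k : ℕ
  k = suc p

  Near : ℕ → Set
  Near δ = δ ≡ 0 ⊎ δ ∈L S ⊎ (k ∸ δ) ∈L S

  near? : ∀ δ → Dec (Near δ)
  near? δ with δ ℕP.≟ 0 | δ ∈ℕ? S | (k ∸ δ) ∈ℕ? S
  ... | yes δ≡0 | _ | _ = yes (inj₁ δ≡0)
  ... | no _ | yes δ∈S | _ = yes (inj₂ (inj₁ δ∈S))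
  ... | no _ | no _ | yes k-δ∈S = yes (inj₂ (inj₂ k-δ∈S))
  ... | no a | no b | no c = no λ { (inj₁ x) → a x ; (inj₂ (inj₁ x)) → b x ; (inj₂ (inj₂ x)) → c x }

  NearMod : ℕ → Set
  NearMod D = Near (D % k)

  mod-below-2k : ∀ s → s < k + k → (s < k × s % k ≡ s) ⊎ (k ≤ s × s % k ≡ s ∸ k)
  mod-below-2k s s<2k with s ℕP.<? k
  ... | yes s<k = inj₁ (s<k , DM.m<n⇒m%n≡m s<k)
  ... | no s≮k = inj₂ (k≤s , s%k≡s∸k)
    where
    open ≡-Reasoning
    k≤s : k ≤ s
    k≤s = ℕP.≮⇒≥ s≮k
    s%k≡s∸k : s % k ≡ s ∸ k
    s%k≡s∸k = begin
      s % k             ≡⟨ cong (_% k) (sym (ℕP.m∸n+n≡m k≤s)) ⟩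
      (s ∸ k + k) % k   ≡⟨ DM.[m+n]%n≡m%n (s ∸ k) k ⟩
      (s ∸ k) % k       ≡⟨ DM.m<n⇒m%n≡m (ℕP.m<n+o⇒m∸n<o s k s<2k) ⟩
      s ∸ k             ∎

  k∸δ%k : ∀ δ → 0 < δ → δ < k → (k ∸ δ) % k ≡ k ∸ δ
  k∸δ%k δ 0<δ δ<k = DM.m<n⇒m%n≡m (ℕP.∸-monoʳ-< 0<δ (ℕP.<⇒≤ δ<k))

  near-flip : ∀ δ → δ < k → Near δ → Near ((k ∸ δ) % k)
  near-flip zero _ _ = inj₁ (DM.n%n≡0 k)
  near-flip (suc δ) δ<k (inj₂ (inj₁ δ∈S)) rewrite k∸δ%k (suc δ) (s≤s z≤n) δ<k =
    inj₂ (inj₂ (subst (_∈L S) (sym (ℕP.m∸[m∸n]≡n (ℕP.<⇒≤ δ<k))) δ∈S))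
  near-flip (suc δ) δ<k (inj₂ (inj₂ k-δ∈S)) rewrite k∸δ%k (suc δ) (s≤s z≤n) δ<k = inj₂ (inj₁ k-δ∈S)

  near-flip⁻ : ∀ δ → δ < k → Near ((k ∸ δ) % k) → Near δ
  near-flip⁻ zero _ _ = inj₁ refl
  near-flip⁻ (suc δ) δ<k near rewrite k∸δ%k (suc δ) (s≤s z≤n) δ<k with near
  ... | inj₁ k-δ≡0 = ⊥-elim (ℕP.<-irrefl (sym k-δ≡0) (ℕP.m<n⇒0<n∸m δ<k))
  ... | inj₂ (inj₁ k-δ∈S) = inj₂ (inj₂ k-δ∈S)
  ... | inj₂ (inj₂ δ∈S) = inj₂ (inj₁ (subst (_∈L S) (ℕP.m∸[m∸n]≡n (ℕP.<⇒≤ δ<k)) δ∈S))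

  complementary-residue : ∀ a b → a < k → b < k → (a + b) % k ≡ 0 → a ≡ (k ∸ b) % k
  complementary-residue a b a<k b<k a+b≡0 with mod-below-2k (a + b) (ℕP.+-mono-< a<k b<k)
  ... | inj₁ (_ , eq) =
    let a+b≡0′ = trans (sym eq) a+b≡0
    in trans (ℕP.m+n≡0⇒m≡0 a a+b≡0′)
             (sym (trans (cong (λ z → (k ∸ z) % k) (ℕP.m+n≡0⇒n≡0 a a+b≡0′)) (DM.n%n≡0 k)))
  ... | inj₂ (k≤a+b , eq) = trans a≡k∸b (sym (k∸δ%k b (0<b b a≡k∸b) b<k))
    where
    a+b≡k : a + b ≡ k
    a+b≡k = ℕP.≤-antisym (ℕP.m∸n≡0⇒m≤n (trans (sym eq) a+b≡0)) k≤a+b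
    a≡k∸b : a ≡ k ∸ b
    a≡k∸b = trans (sym (ℕP.m+n∸n≡m a b)) (cong (_∸ b) a+b≡k)
    0<b : ∀ b → a ≡ k ∸ b → 0 < b
    0<b zero a≡k = ⊥-elim (ℕP.<-irrefl a≡k a<k)
    0<b (suc b) _ = s≤s z≤n

  nearMod-complement : ∀ M D → D ≤ M → M % k ≡ 0 → NearMod D → NearMod (M ∸ D)
  nearMod-complement M D D≤M M%k≡0 near =
    subst Near (sym residue) (near-flip (D % k) (DM.m%n<n D k) near)
    where
    residue : (M ∸ D) % k ≡ (k ∸ D % k) % k
    residue = complementary-residue _ _ (DM.m%n<n (M ∸ D) k) (DM.m%n<n D k)
      (trans (sym (DM.%-distribˡ-+ (M ∸ D) D k)) (trans (cong (_% k) (ℕP.m∸n+n≡m D≤M)) M%k≡0))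

  nearMod-complement⁻ : ∀ M D → D ≤ M → M % k ≡ 0 → NearMod (M ∸ D) → NearMod D
  nearMod-complement⁻ M D D≤M M%k≡0 near =
    subst NearMod (ℕP.m∸[m∸n]≡n D≤M) (nearMod-complement M (M ∸ D) (ℕP.m∸n≤m M D) M%k≡0 near)

  residue-of-difference : ∀ d A B → d < k → A < k → B < k → (d + B) % k ≡ A →
                          (d ≡ ℕ.∣ A - B ∣) ⊎ (d ≡ (k ∸ ℕ.∣ A - B ∣) % k)
  residue-of-difference d A B d<k A<k B<k d+B≡A with mod-below-2k (d + B) (ℕP.+-mono-< d<k B<k)
  ... | inj₁ (_ , eq) = inj₁ (begin
      d                       ≡⟨ sym (ℕP.∣m-m+n∣≡n B d) ⟩
      ℕ.∣ B - B + d ∣         ≡⟨ cong (λ z → ℕ.∣ B - z ∣) (ℕP.+-comm B d) ⟩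
      ℕ.∣ B - d + B ∣         ≡⟨ ℕP.∣-∣-comm B (d + B) ⟩
      ℕ.∣ d + B - B ∣         ≡⟨ cong (λ z → ℕ.∣ z - B ∣) (trans (sym eq) d+B≡A) ⟩
      ℕ.∣ A - B ∣             ∎)
    where open ≡-Reasoning
  ... | inj₂ (k≤d+B , eq) = inj₂ goal
    where
    d+B≡A+k : d + B ≡ A + k
    d+B≡A+k = trans (sym (ℕP.m∸n+n≡m k≤d+B)) (cong (_+ k) (trans (sym eq) d+B≡A))
    A<B : A < B
    A<B = ℕP.+-cancelʳ-< k A B
            (subst (_< B + k) d+B≡A+k (subst (d + B <_) (ℕP.+-comm k B) (ℕP.+-monoˡ-< B d<k)))
    d+[B∸A]≡k : d + (B ∸ A) ≡ k
    d+[B∸A]≡k = ℕP.+-cancelʳ-≡ A _ _ (trans (ℕP.+-assoc d (B ∸ A) A)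
                  (trans (cong (d +_) (ℕP.m∸n+n≡m (ℕP.<⇒≤ A<B))) (trans d+B≡A+k (ℕP.+-comm A k))))
    goal : d ≡ (k ∸ ℕ.∣ A - B ∣) % k
    goal rewrite ℕP.m≤n⇒∣m-n∣≡n∸m (ℕP.<⇒≤ A<B) =
      trans (sym (trans (cong (_∸ (B ∸ A)) (sym d+[B∸A]≡k)) (ℕP.m+n∸n≡m d (B ∸ A))))
            (sym (k∸δ%k (B ∸ A) (ℕP.m<n⇒0<n∸m A<B) (ℕP.≤-<-trans (ℕP.m∸n≤m B A) B<k)))

  DistanceResidue : ℕ → ℕ → ℕ → ℕ → Set
  DistanceResidue A B j l =
    (ℕ.∣ (A + j * k) - (B + l * k) ∣ % k ≡ ℕ.∣ A - B ∣) ⊎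
    (ℕ.∣ (A + j * k) - (B + l * k) ∣ % k ≡ (k ∸ ℕ.∣ A - B ∣) % k)

  distance-residue-≤ : ∀ A B j l → A < k → B < k → B + l * k ≤ A + j * k → DistanceResidue A B j l
  distance-residue-≤ A B j l A<k B<k Y≤X = residue-of-difference (D % k) A B (DM.m%n<n D k) A<k B<k sum
    where
    X Y D : ℕ
    X = A + j * k
    Y = B + l * k
    D = ℕ.∣ X - Y ∣
    sum : (D % k + B) % k ≡ A
    sum = begin
      (D % k + B) % k       ≡⟨ cong (λ z → (D % k + z) % k)
                                 (sym (trans (DM.[m+kn]%n≡m%n B l k) (DM.m<n⇒m%n≡m B<k))) ⟩
      (D % k + Y % k) % k   ≡⟨ sym (DM.%-distribˡ-+ D Y k) ⟩
      (D + Y) % k           ≡⟨ cong (λ z → (z + Y) % k) (ℕP.m≤n⇒∣n-m∣≡n∸m Y≤X) ⟩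
      (X ∸ Y + Y) % k       ≡⟨ cong (_% k) (ℕP.m∸n+n≡m Y≤X) ⟩
      X % k                 ≡⟨ DM.[m+kn]%n≡m%n A j k ⟩
      A % k                 ≡⟨ DM.m<n⇒m%n≡m A<k ⟩
      A                     ∎
      where open ≡-Reasoning

  distance-residue : ∀ A B j l → A < k → B < k → DistanceResidue A B j l
  distance-residue A B j l A<k B<k with ℕP.≤-total (B + l * k) (A + j * k)
  ... | inj₁ Y≤X = distance-residue-≤ A B j l A<k B<k Y≤X
  ... | inj₂ X≤Y rewrite ℕP.∣-∣-comm (A + j * k) (B + l * k) | ℕP.∣-∣-comm A B =
    distance-residue-≤ B A l j B<k A<k X≤Y

  nearMod⇔near : ∀ A B j l → A < k → B < k → NearMod ℕ.∣ (A + j * k) - (B + l * k) ∣ ⇔ Near ℕ.∣ A - B ∣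
  nearMod⇔near A B j l A<k B<k with distance-residue A B j l A<k B<k
  ... | inj₁ eq = mk⇔ (subst Near eq) (subst Near (sym eq))
  ... | inj₂ eq = mk⇔ (λ near → near-flip⁻ _ δ<k (subst Near eq near))
                      (λ near → subst Near (sym eq) (near-flip _ δ<k near))
    where
    δ<k : ℕ.∣ A - B ∣ < k
    δ<k = ℕP.≤-<-trans (ℕP.∣m-n∣≤m⊔n A B) (ℕP.⊔-lub A<k B<k)

module LexOfCirculant (G : Graph) (p : ℕ) (S : List ℕ)
  (bounds : All (λ s → 1 ≤ s × s ≤ suc p ℕ./ 2) S) (iso : G ≅ Circ (suc p) S) (m′ : ℕ) where

  open CirculantAdjacency G (suc p) S (s≤s z≤n) bounds iso using (τ; adj?; irrefl)
  open LexicographicProduct G adj? irrefl m′ using (m; n; N; H; base; copy; vertex-≡)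
  open CirculantArithmetic p S

  M : ℕ
  M = m * k

  Difference : ℕ → Set
  Difference d = 1 ≤ d × NearMod d

  difference? : ∀ d → Dec (Difference d)
  difference? d = (1 ℕP.≤? d) ×-dec near? (d % k)

  S′ : List ℕ
  S′ = List.filter difference? (List.upTo (suc (M ℕ./ 2)))

  ∈S′⁻ : ∀ {d} → d ∈L S′ → d ≤ M ℕ./ 2 × Difference d
  ∈S′⁻ d∈S′ with ∈-filter⁻ difference? d∈S′
  ... | d∈upTo , diff = ℕ.s≤s⁻¹ (∈-upTo⁻ d∈upTo) , diff

  ∈S′⁺ : ∀ {d} → d ≤ M ℕ./ 2 → Difference d → d ∈L S′
  ∈S′⁺ d≤ diff = ∈-filter⁺ difference? (∈-upTo⁺ (s≤s d≤)) diff

  S′-bounds : All (λ s → 1 ≤ s × s ≤ M ℕ./ 2) S′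
  S′-bounds = All.tabulate λ d∈S′ → proj₁ (proj₂ (∈S′⁻ d∈S′)) , proj₁ (∈S′⁻ d∈S′)

  M≰M/2 : ¬ (M ≤ M ℕ./ 2)
  M≰M/2 M≤ = ℕP.<-irrefl refl (ℕP.≤-<-trans M≤ (DM.m/n<m M 2 (s≤s (s≤s z≤n))))

  M≤1+2[M/2] : M ≤ suc (M ℕ./ 2 + M ℕ./ 2)
  M≤1+2[M/2] = begin
    M                         ≡⟨ DM.m≡m%n+[m/n]*n M 2 ⟩
    M % 2 + M ℕ./ 2 * 2        ≤⟨ ℕP.+-monoˡ-≤ (M ℕ./ 2 * 2) (ℕ.s≤s⁻¹ (DM.m%n<n M 2)) ⟩
    1 + M ℕ./ 2 * 2            ≡⟨ cong suc (trans (ℕP.*-comm (M ℕ./ 2) 2)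
                                               (cong (M ℕ./ 2 +_) (ℕP.+-identityʳ (M ℕ./ 2)))) ⟩
    suc (M ℕ./ 2 + M ℕ./ 2)    ∎
    where open ℕP.≤-Reasoning

  circAdj⇒ : ∀ D → D < M → (D ∈L S′ ⊎ (M ∸ D) ∈L S′) → D ≢ 0 × NearMod D
  circAdj⇒ D D<M (inj₁ D∈S′) with ∈S′⁻ D∈S′
  ... | _ , 1≤D , near = (λ { refl → ℕP.<-irrefl refl 1≤D }) , near
  circAdj⇒ D D<M (inj₂ M-D∈S′) with ∈S′⁻ M-D∈S′
  ... | M-D≤ , _ , near =
    (λ { refl → M≰M/2 M-D≤ }) , nearMod-complement⁻ M D (ℕP.<⇒≤ D<M) (DM.m*n%n≡0 m k) near

  circAdj⇐ : ∀ D → D < M → D ≢ 0 → NearMod D → (D ∈L S′ ⊎ (M ∸ D) ∈L S′)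
  circAdj⇐ D D<M D≢0 near with D ℕP.≤? M ℕ./ 2
  ... | yes D≤ = inj₁ (∈S′⁺ D≤ (ℕP.n≢0⇒n>0 D≢0 , near))
  ... | no D≰ =
    inj₂ (∈S′⁺ M-D≤ (ℕP.m<n⇒0<n∸m D<M , nearMod-complement M D (ℕP.<⇒≤ D<M) (DM.m*n%n≡0 m k) near))
    where
    M-D≤ : M ∸ D ≤ M ℕ./ 2
    M-D≤ = ℕP.m≤n+o⇒m∸n≤o M D (ℕP.≤-trans M≤1+2[M/2] (ℕP.+-monoˡ-≤ (M ℕ./ 2) (ℕP.≰⇒> D≰)))

  σ : Fin n ↔ Fin k
  σ = proj₁ iso
  τ⁻¹ : Fin k → Fin n
  τ⁻¹ = Inverse.from σ

  τ-injective : ∀ a b → τ a ≡ τ b → a ≡ b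
  τ-injective a b eq =
    trans (sym (Inverse.strictlyInverseʳ σ a)) (trans (cong τ⁻¹ eq) (Inverse.strictlyInverseʳ σ b))

  φ : Fin N → Fin M
  φ u = Fin.combine (copy u) (τ (base u))

  φ⁻¹ : Fin M → Fin N
  φ⁻¹ w = Fin.combine (τ⁻¹ (proj₂ (Fin.remQuot {m} k w))) (proj₁ (Fin.remQuot {m} k w))

  φ⁻¹∘φ : ∀ u → φ⁻¹ (φ u) ≡ u
  φ⁻¹∘φ u = begin
    φ⁻¹ (φ u)                                   ≡⟨ cong (λ z → Fin.combine (τ⁻¹ (proj₂ z)) (proj₁ z))
                                                        (FinP.remQuot-combine {m} {k} (copy u) (τ (base u))) ⟩
    Fin.combine (τ⁻¹ (τ (base u))) (copy u)     ≡⟨ cong (λ z → Fin.combine z (copy u))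
                                                        (Inverse.strictlyInverseʳ σ (base u)) ⟩
    Fin.combine (base u) (copy u)               ≡⟨ FinP.combine-remQuot {n} m u ⟩
    u                                           ∎
    where open ≡-Reasoning

  φ∘φ⁻¹ : ∀ w → φ (φ⁻¹ w) ≡ w
  φ∘φ⁻¹ w = begin
    φ (φ⁻¹ w)                                   ≡⟨ cong (λ z → Fin.combine (proj₂ z) (τ (proj₁ z)))
                                                        (FinP.remQuot-combine {n} {m} (τ⁻¹ j) i) ⟩
    Fin.combine i (τ (τ⁻¹ j))                   ≡⟨ cong (Fin.combine i) (Inverse.strictlyInverseˡ σ j) ⟩
    Fin.combine i j                             ≡⟨ FinP.combine-remQuot {m} k w ⟩
    w                                           ∎
    where
    open ≡-Reasoning
    i : Fin m
    i = proj₁ (Fin.remQuot {m} k w)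
    j : Fin k
    j = proj₂ (Fin.remQuot {m} k w)

  toℕ-φ : ∀ u → toℕ (φ u) ≡ toℕ (τ (base u)) + toℕ (copy u) * k
  toℕ-φ u = trans (FinP.toℕ-combine (copy u) (τ (base u)))
              (trans (ℕP.+-comm (k * toℕ (copy u)) _)
                     (cong (toℕ (τ (base u)) +_) (ℕP.*-comm k (toℕ (copy u)))))

  module _ (a b : Fin N) where
    private
      A B D : ℕ
      A = toℕ (τ (base a))
      B = toℕ (τ (base b))
      D = ℕ.∣ toℕ (φ a) - toℕ (φ b) ∣

    D≡0⇒ : D ≡ 0 → copy a ≡ copy b × τ (base a) ≡ τ (base b)
    D≡0⇒ D≡0 = FinP.combine-injective (copy a) (τ (base a)) (copy b) (τ (base b))
                  (FinP.toℕ-injective (ℕP.∣m-n∣≡0⇒m≡n D≡0))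

    lexAdj⇒ : Adj H a b → D ≢ 0 × Near ℕ.∣ A - B ∣
    lexAdj⇒ (inj₁ a~b) =
      (λ D≡0 → irrefl (base a) (subst (Adj G (base a)) (sym (τ-injective _ _ (proj₂ (D≡0⇒ D≡0)))) a~b)) ,
      inj₂ (Equivalence.to (proj₂ iso (base a) (base b)) a~b)
    lexAdj⇒ (inj₂ (ba≡bb , ca≢cb)) =
      (λ D≡0 → ca≢cb (proj₁ (D≡0⇒ D≡0))) , inj₁ (ℕP.m≡n⇒∣m-n∣≡0 (cong (λ z → toℕ (τ z)) ba≡bb))

    lexAdj⇐ : D ≢ 0 → Near ℕ.∣ A - B ∣ → Adj H a b
    lexAdj⇐ D≢0 (inj₁ δ≡0) =
      inj₂ (ba≡bb , λ ca≡cb → D≢0 (ℕP.m≡n⇒∣m-n∣≡0 (cong toℕ (cong₂ Fin.combine ca≡cb (cong τ ba≡bb)))))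
      where
      ba≡bb : base a ≡ base b
      ba≡bb = τ-injective _ _ (FinP.toℕ-injective (ℕP.∣m-n∣≡0⇒m≡n δ≡0))
    lexAdj⇐ _ (inj₂ c) = inj₁ (Equivalence.from (proj₂ iso (base a) (base b)) c)

    φ-adjacency : Adj H a b ⇔ Adj (Circ M S′) (φ a) (φ b)
    φ-adjacency = mk⇔ to fr
      where
      D≡ : D ≡ ℕ.∣ (A + toℕ (copy a) * k) - (B + toℕ (copy b) * k) ∣
      D≡ = cong₂ ℕ.∣_-_∣ (toℕ-φ a) (toℕ-φ b)
      D<M : D < M
      D<M = ℕP.≤-<-trans (ℕP.∣m-n∣≤m⊔n (toℕ (φ a)) (toℕ (φ b)))
                         (ℕP.⊔-lub (FinP.toℕ<n (φ a)) (FinP.toℕ<n (φ b)))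
      near⇔ : NearMod ℕ.∣ (A + toℕ (copy a) * k) - (B + toℕ (copy b) * k) ∣ ⇔ Near ℕ.∣ A - B ∣
      near⇔ = nearMod⇔near A B (toℕ (copy a)) (toℕ (copy b)) (FinP.toℕ<n _) (FinP.toℕ<n _)
      to : Adj H a b → Adj (Circ M S′) (φ a) (φ b)
      to a~b with lexAdj⇒ a~b
      ... | D≢0 , near = circAdj⇐ D D<M D≢0 (subst NearMod (sym D≡) (Equivalence.from near⇔ near))
      fr : Adj (Circ M S′) (φ a) (φ b) → Adj H a b
      fr adj with circAdj⇒ D D<M adj
      ... | D≢0 , near = lexAdj⇐ D≢0 (Equivalence.to near⇔ (subst NearMod D≡ near))

  lex-circulant : IsCirculant H
  lex-circulant = M , S′ , s≤s z≤n , S′-bounds , mk↔ₛ′ φ φ⁻¹ φ∘φ⁻¹ φ⁻¹∘φ , φ-adjacency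

theorem4p2 : (G : Graph) → IsCirculant G →
    ((VertexDecomposable (Ind G) →
      ∀ (m : ℕ) → 1 ≤ m →
        IsCirculant (Lex G (K m)) × VertexDecomposable (Ind (Lex G (K m))))
    × (Shellable (Ind G) →
      ∀ (m : ℕ) → 1 ≤ m →
        IsCirculant (Lex G (K m)) × Shellable (Ind (Lex G (K m)))))
theorem4p2 G (suc p , S , s≤s z≤n , bounds , iso) = vd , shellable
  where
  open CirculantAdjacency G (suc p) S (s≤s z≤n) bounds iso using (adj?; irrefl)
  vd : VertexDecomposable (Ind G) → ∀ m → 1 ≤ m →
       IsCirculant (Lex G (K m)) × VertexDecomposable (Ind (Lex G (K m)))
  vd vdG (suc m′) _ = LexOfCirculant.lex-circulant G p S bounds iso m′ ,
                      LexicographicProduct.vd-lex G adj? irrefl m′ vdG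
  shellable : Shellable (Ind G) → ∀ m → 1 ≤ m →
              IsCirculant (Lex G (K m)) × Shellable (Ind (Lex G (K m)))
  shellable shG (suc m′) _ = LexOfCirculant.lex-circulant G p S bounds iso m′ ,
                             LexicographicProduct.shellable-lex G adj? irrefl m′ shG
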